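{- Let $n \ge 1$ be an integer such that $2n+1$ is a prime, and let $S$ be a perfect dominating set of the graph $C_{2n+1}^n$ (the Cartesian product of $n$ copies of the cycle of length $2n+1$). Identify the vertices of $C_{2n+1}^n$ with $\mathbb{Z}_{2n+1}^n$, where $x \sim y$ if and only if $x - y = \pm e_i$ for some $i \in \{1,\ldots,n\}$ ($e_i$ the $i$-th unit vector). Then for every $(x_1,\ldots,x_n) \in \mathbb{Z}_{2n+1}^n$ and every $i \in \{1,\ldots,n\}$, $$\left| S \cap \{(y_1,\ldots,y_n) \in \mathbb{Z}_{2n+1}^n : y_j = x_j \text{ for all } j \neq i\}\right| = 1.$$
   Context: A vertex $u$ dominates a vertex $v$ if $u = v$ or $u$ is adjacent to $v$. A set $S$ of vertices is a dominating set if every vertex is dominated by at least one vertex of $S$; it is a perfect dominating set if moreover every vertex is dominated by exactly one vertex of $S$. The Cartesian product of graphs $G$ and $H$ has vertex set $V(G)\times V(H)$, with $(x,y)\sim(x',y')$ iff ($x=x'$ and $y\sim y'$) or ($x\sim x'$ and $y=y'$). -}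

module Defs where

open import Data.Nat using (ℕ; zero; suc; _+_; _*_)
open import Data.Nat.Primality using (Prime)
open import Data.Fin using (Fin; zero; suc; toℕ; fromℕ<)
open import Data.Nat.DivMod using (_mod_)
open import Data.Vec using (Vec; lookup)
open import Data.Product using (Σ; _×_; ∃; ∃-syntax)
open import Data.Sum using (_⊎_)
open import Relation.Binary.PropositionalEquality using (_≡_; _≢_)

sucMod : ∀ {k} → Fin (suc k) → Fin (suc k)
sucMod {k} x = suc (toℕ x) mod (suc k)

CycleAdj : ∀ {k} → Fin (suc k) → Fin (suc k) → Set
CycleAdj x y = (y ≡ sucMod x) ⊎ (x ≡ sucMod y)

Vertex : ℕ → ℕ → Set
Vertex k n = Vec (Fin (suc k)) n

Adj : ∀ {k n} → Vertex k n → Vertex k n → Set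
Adj {n = n} x y =
  ∃[ i ] (CycleAdj (lookup x i) (lookup y i)
          × (∀ j → j ≢ i → lookup x j ≡ lookup y j))

Dominates : ∀ {k n} → Vertex k n → Vertex k n → Set
Dominates u v = (u ≡ v) ⊎ Adj u v

ExactlyOne : ∀ {A : Set} → (A → Set) → Set
ExactlyOne {A} P = Σ A (λ a → P a × (∀ b → P b → b ≡ a))

PerfectDominating : ∀ {k n} → (Vertex k n → Set) → Set
PerfectDominating {k} {n} S =
  ∀ (v : Vertex k n) → ExactlyOne (λ s → S s × Dominates s v)

module Submission where

-- Let χ be the indicator of S and g = p·χ − 1, where p = 2n + 1. Every closed neighbourhood
-- has p vertices, exactly one of them in S, so g sums to 0 over each closed neighbourhood.
-- Projecting along κ ∈ ℤₚⁿ, B_κ(t) = Σ {g z | κ·z ≡ −t}, turns this into B_κ ⋆ ν_κ = 0 on ℤₚ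
-- for an explicit weight ν_κ. Modulo constants, ℤ[x]/(xᵖ − 1) is ℤ[ζₚ], which has no zero
-- divisors, so B_κ is constant as soon as ν_κ is not. We prove this elementarily: p divides
-- the total of B_κ ⋆ ν_κ, hence of one factor, from which a factor ∇ = 1 − x can be split
-- off; repeating, one factor lies in arbitrarily high powers of (∇), and ∇ᵖ ∈ p·ℤ[x]/(xᵖ − 1)
-- makes it constant modulo arbitrarily high powers of p. If κᵢ = 0 then ν_κ is not constant
-- and B_κ = 0, since Σ g = 0. Summing these vanishing projections over all κ with κᵢ = 0
-- inverts the projection: g sums to 0 along every line in direction i, i.e. each such line
-- contains exactly one vertex of S.

open import Defs
open import Function using (_∘_)
open import Level using (0ℓ)
open import Data.Nat as ℕ using (ℕ; zero; suc; _≥_)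
import Data.Nat.Properties as ℕ
import Data.Nat.Divisibility as ℕ
import Data.Nat.Tactic.RingSolver as ℕSolver
open import Data.Nat.DivMod
  using (_%_; _/_; _mod_; m≡m%n+[m/n]*n; m*[n/m]≡n; %-distribˡ-+; %-distribˡ-*; m%n%n≡m%n; [m+kn]%n≡m%n;
         m<n⇒m%n≡m; m%n<n)
open import Data.Nat.Primality using (Prime; euclidsLemma; prime⇒nonTrivial)
open import Data.Nat.Coprimality using (prime⇒coprime; coprime-Bézout)
open import Data.Nat.GCD using (module Bézout)
open import Data.Nat.Combinatorics using (_C_; nCn≡1; k>n⇒nCk≡0) renaming (nCk+nC[k+1]≡[n+1]C[k+1] to pascal)
open import Data.Fin as Fin using (Fin; toℕ)
import Data.Fin.Properties as Fin
open import Data.Vec using (Vec; []; _∷_; lookup; updateAt)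
import Data.Vec.Properties as Vec
open import Data.Integer as ℤ using (ℤ; +_; 0ℤ; 1ℤ; -1ℤ; ∣_∣; _≤_; +≤+)
open import Data.Integer.Properties
open import Data.Integer.Divisibility.Signed using (_∣_; divides; ∣m∣n⇒∣m+n; ∣⇒∣ᵤ; ∣ᵤ⇒∣)
open import Data.Integer.Tactic.RingSolver using (solve-∀)
open import Algebra.Properties.Semiring.Sum +-*-semiring
open import Algebra.Properties.AbelianGroup +-0-abelianGroup using () renaming (∙-cancelˡ to +-cancelˡ)
open import Algebra.Properties.Ring +-*-ring using (x[y-z]≈xy-xz; [y-z]x≈yx-zx)
open import Data.Product using (Σ-syntax; _×_; _,_; proj₁; proj₂)
open import Data.Sum using (_⊎_; inj₁; inj₂; [_,_])
open import Relation.Nullary using (¬_; Dec; yes; no; contradiction)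
open import Relation.Binary.Bundles using (Setoid)
import Relation.Binary.Reasoning.Setoid as SetoidReasoning
open import Relation.Binary.PropositionalEquality hiding ([_])

module _ {A : Set} {d : ℕ} where

  lookup-extensionality : ∀ {u v : Vec A d} → (∀ j → lookup u j ≡ lookup v j) → u ≡ v
  lookup-extensionality {u} {v} u≗v =
    trans (sym (Vec.tabulate∘lookup u)) (trans (Vec.tabulate-cong u≗v) (Vec.tabulate∘lookup v))

  ≡updateAt : ∀ {s v : Vec A d} {σ : A → A} i → lookup s i ≡ σ (lookup v i) →
              (∀ j → j ≢ i → lookup s j ≡ lookup v j) → s ≡ updateAt v i σ
  ≡updateAt {s} {v} {σ} i sᵢ≡ s≗v = lookup-extensionality pointwise
    where
    pointwise : ∀ j → lookup s j ≡ lookup (updateAt v i σ) j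
    pointwise j with j Fin.≟ i
    ... | yes refl = trans sᵢ≡ (sym (Vec.lookup∘updateAt j v))
    ... | no j≢i   = trans (s≗v j j≢i) (sym (Vec.lookup∘updateAt′ j i j≢i v))

  updateAt-≢ : ∀ (v : Vec A d) j {σ : A → A} → (∀ a → σ a ≢ a) → updateAt v j σ ≢ v
  updateAt-≢ v j σa≢a e = σa≢a (lookup v j) (trans (sym (Vec.lookup∘updateAt j v)) (cong (λ w → lookup w j) e))

  updateAt-≢-same : ∀ (v : Vec A d) j {σ τ : A → A} → (∀ a → σ a ≢ τ a) →
                    updateAt v j σ ≢ updateAt v j τ
  updateAt-≢-same v j σa≢τa e = σa≢τa (lookup v j)
    (trans (sym (Vec.lookup∘updateAt j v)) (trans (cong (λ w → lookup w j) e) (Vec.lookup∘updateAt j v)))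

  updateAt-≢-other : ∀ (v : Vec A d) {j i} {σ τ : A → A} → j ≢ i → (∀ a → σ a ≢ a) →
                     updateAt v j σ ≢ updateAt v i τ
  updateAt-≢-other v {j} {i} j≢i σa≢a e = σa≢a (lookup v j)
    (trans (sym (Vec.lookup∘updateAt j v)) (trans (cong (λ w → lookup w j) e) (Vec.lookup∘updateAt′ j i j≢i v)))

module Sums where

  open import Data.Integer using (_+_; _*_; -_; _-_)

  ∑-zero : ∀ {n} {f : Fin n → ℤ} → (∀ i → f i ≡ 0ℤ) → sum f ≡ 0ℤ
  ∑-zero {n} f≗0 = trans (sum-cong-≗ f≗0) (sum-replicate-zero n)

  ∑-const : ∀ n c → ∑[ i < n ] c ≡ + n * c
  ∑-const zero    c = sym (*-zeroˡ c)
  ∑-const (suc n) c = begin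
    c + ∑[ i < n ] c   ≡⟨ cong (_+_ c) (∑-const n c) ⟩
    c + + n * c        ≡⟨ cong (_+ + n * c) (*-identityˡ c) ⟨
    1ℤ * c + + n * c   ≡⟨ *-distribʳ-+ c 1ℤ (+ n) ⟨
    + suc n * c        ∎
    where open ≡-Reasoning

  ∑-neg : ∀ {n} (f : Fin n → ℤ) → ∑[ i < n ] (- f i) ≡ - sum f
  ∑-neg {zero}  f = refl
  ∑-neg {suc n} f = trans (cong (_+_ (- f Fin.zero)) (∑-neg (f ∘ Fin.suc)))
                          (sym (neg-distrib-+ (f Fin.zero) (sum (f ∘ Fin.suc))))

  ∑-distrib-- : ∀ {n} (f g : Fin n → ℤ) → ∑[ i < n ] (f i - g i) ≡ sum f - sum g
  ∑-distrib-- f g = trans (∑-distrib-+ f (-_ ∘ g)) (cong (_+_ (sum f)) (∑-neg g))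

  ∑ℕ-last : ∀ n (f : ℕ → ℤ) → ∑[ s < suc n ] f (toℕ s) ≡ ∑[ s < n ] f (toℕ s) + f n
  ∑ℕ-last zero    f = +-comm (f 0) 0ℤ
  ∑ℕ-last (suc n) f = trans (cong (_+_ (f 0)) (∑ℕ-last n (f ∘ suc))) (sym (+-assoc (f 0) _ _))

  ∑ℕ-split : ∀ m n (f : ℕ → ℤ) →
             ∑[ s < m ℕ.+ n ] f (toℕ s) ≡ ∑[ s < m ] f (toℕ s) + ∑[ s < n ] f (m ℕ.+ toℕ s)
  ∑ℕ-split zero    n f = sym (+-identityˡ _)
  ∑ℕ-split (suc m) n f = trans (cong (_+_ (f 0)) (∑ℕ-split m n (f ∘ suc))) (sym (+-assoc (f 0) _ _))

  ∑-point : ∀ {n} (f : Fin n → ℤ) i → (∀ j → j ≢ i → f j ≡ 0ℤ) → sum f ≡ f i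
  ∑-point f Fin.zero    f≗0 = trans (cong (_+_ (f Fin.zero)) (∑-zero (λ j → f≗0 (Fin.suc j) λ ())))
                                    (+-identityʳ _)
  ∑-point f (Fin.suc i) f≗0 = trans (cong₂ _+_ (f≗0 Fin.zero λ ()) (∑-point (f ∘ Fin.suc) i
                                       (λ j j≢i → f≗0 (Fin.suc j) (j≢i ∘ Fin.suc-injective))))
                                    (+-identityˡ _)

  ∑-nonneg : ∀ {n} {f : Fin n → ℤ} → (∀ i → 0ℤ ≤ f i) → 0ℤ ≤ sum f
  ∑-nonneg {zero}  f≥0 = ≤-refl
  ∑-nonneg {suc n} f≥0 = +-mono-≤ (f≥0 Fin.zero) (∑-nonneg (f≥0 ∘ Fin.suc))

  ∑-≥-term : ∀ {n} {f : Fin n → ℤ} → (∀ i → 0ℤ ≤ f i) → ∀ i → f i ≤ sum f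
  ∑-≥-term {suc n} {f} f≥0 Fin.zero    =
    subst (_≤ sum f) (+-identityʳ _) (+-monoʳ-≤ (f Fin.zero) (∑-nonneg (f≥0 ∘ Fin.suc)))
  ∑-≥-term {suc n} {f} f≥0 (Fin.suc i) = ≤-trans (∑-≥-term (f≥0 ∘ Fin.suc) i)
    (subst (_≤ sum f) (+-identityˡ _) (+-monoˡ-≤ (sum (f ∘ Fin.suc)) (f≥0 Fin.zero)))

  Bit : ℤ → Set
  Bit x = x ≡ 0ℤ ⊎ x ≡ 1ℤ

  bit⇒nonneg : ∀ {x} → Bit x → 0ℤ ≤ x
  bit⇒nonneg (inj₁ refl) = ≤-refl
  bit⇒nonneg (inj₂ refl) = +≤+ ℕ.z≤n

  ∑-bits≡1⇒exactlyOne : ∀ {n} {f : Fin n → ℤ} → (∀ i → Bit (f i)) → sum f ≡ 1ℤ →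
                        ExactlyOne (λ i → f i ≡ 1ℤ)
  ∑-bits≡1⇒exactlyOne {suc n} {f} bits ∑f≡1 with bits Fin.zero
  ... | inj₂ f₀≡1 = Fin.zero , f₀≡1 , unique
    where
    rest≡0 : sum (f ∘ Fin.suc) ≡ 0ℤ
    rest≡0 = +-cancelˡ 1ℤ _ _ (trans (cong (_+ sum (f ∘ Fin.suc)) (sym f₀≡1))
                                     (trans ∑f≡1 (sym (+-identityʳ 1ℤ))))
    unique : ∀ j → f j ≡ 1ℤ → j ≡ Fin.zero
    unique Fin.zero    _     = refl
    unique (Fin.suc j) fj≡1 with +≤+ () ← subst (_≤ 0ℤ) fj≡1
      (subst (f (Fin.suc j) ≤_) rest≡0 (∑-≥-term (bit⇒nonneg ∘ bits ∘ Fin.suc) j))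
  ... | inj₁ f₀≡0 = shift (∑-bits≡1⇒exactlyOne (bits ∘ Fin.suc) rest≡1)
    where
    rest≡1 : sum (f ∘ Fin.suc) ≡ 1ℤ
    rest≡1 = trans (sym (+-identityˡ _)) (trans (cong (_+ sum (f ∘ Fin.suc)) (sym f₀≡0)) ∑f≡1)
    shift : ExactlyOne (λ i → f (Fin.suc i) ≡ 1ℤ) → ExactlyOne (λ i → f i ≡ 1ℤ)
    shift (w , fw≡1 , unique) = Fin.suc w , fw≡1 , λ where
      Fin.zero    f₀≡1 → contradiction (trans (sym f₀≡0) f₀≡1) λ ()
      (Fin.suc j) fj≡1 → cong Fin.suc (unique j fj≡1)

  ∣-sum : ∀ {d n} {f : Fin n → ℤ} → (∀ i → d ∣ f i) → d ∣ sum f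
  ∣-sum {d} {zero}  d∣f = divides 0ℤ (sym (*-zeroˡ d))
  ∣-sum {d} {suc n} d∣f = ∣m∣n⇒∣m+n (d∣f Fin.zero) (∣-sum (d∣f ∘ Fin.suc))

  𝟙 : ∀ {A : Set} → Dec A → ℤ
  𝟙 (yes _) = 1ℤ
  𝟙 (no _)  = 0ℤ

  𝟙-yes : ∀ {A : Set} (d : Dec A) → A → 𝟙 d ≡ 1ℤ
  𝟙-yes (yes _) _ = refl
  𝟙-yes (no ¬a) a = contradiction a ¬a

  𝟙-no : ∀ {A : Set} (d : Dec A) → ¬ A → 𝟙 d ≡ 0ℤ
  𝟙-no (yes a) ¬a = contradiction a ¬a
  𝟙-no (no _)  _  = refl

  𝟙-bit : ∀ {A : Set} (d : Dec A) → Bit (𝟙 d)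
  𝟙-bit (yes _) = inj₂ refl
  𝟙-bit (no _)  = inj₁ refl

  𝟙≡1⇒ : ∀ {A : Set} (d : Dec A) → 𝟙 d ≡ 1ℤ → A
  𝟙≡1⇒ (yes a) _ = a

  m∣n∧n<m⇒n≡0 : ∀ {m n} → m ℕ.∣ n → n ℕ.< m → n ≡ 0
  m∣n∧n<m⇒n≡0 {n = zero}  _   _   = refl
  m∣n∧n<m⇒n≡0 {n = suc n} m∣n n<m = contradiction m∣n (ℕ.>⇒∤ n<m)

  small-multiple≡0 : ∀ {Q x} → + Q ∣ x → ∣ x ∣ ℕ.< Q → x ≡ 0ℤ
  small-multiple≡0 Q∣x |x|<Q = ∣i∣≡0⇒i≡0 (m∣n∧n<m⇒n≡0 (∣⇒∣ᵤ Q∣x) |x|<Q)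

module Differences where

  open import Data.Integer using (_+_; _*_; -_; _-_; _^_)
  open Sums

  ∇ : (ℕ → ℤ) → ℕ → ℤ
  ∇ f t = f t - f (suc t)

  ∇^ : ℕ → (ℕ → ℤ) → ℕ → ℤ
  ∇^ zero    f = f
  ∇^ (suc i) f = ∇ (∇^ i f)

  ∇^-cong : ∀ i {f g} → (∀ t → f t ≡ g t) → ∀ t → ∇^ i f t ≡ ∇^ i g t
  ∇^-cong zero    f≗g t = f≗g t
  ∇^-cong (suc i) f≗g t = cong₂ _-_ (∇^-cong i f≗g t) (∇^-cong i f≗g (suc t))

  ∇^-+ : ∀ a b f t → ∇^ (a ℕ.+ b) f t ≡ ∇^ a (∇^ b f) t
  ∇^-+ zero    b f t = refl
  ∇^-+ (suc a) b f t = cong₂ _-_ (∇^-+ a b f t) (∇^-+ a b f (suc t))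

  ∇^-*ˡ : ∀ i c f t → ∇^ i (λ u → c * f u) t ≡ c * ∇^ i f t
  ∇^-*ˡ zero    c f t = refl
  ∇^-*ˡ (suc i) c f t = trans (cong₂ _-_ (∇^-*ˡ i c f t) (∇^-*ˡ i c f (suc t)))
                              (sym (x[y-z]≈xy-xz c (∇^ i f t) (∇^ i f (suc t))))

  C-absorb : ∀ n j → suc j ℕ.* (suc n C suc j) ≡ suc n ℕ.* (n C j)
  C-absorb zero    zero    = refl
  C-absorb zero    (suc j) = ℕ.*-zeroʳ (suc (suc j))
  C-absorb (suc n) j       = begin
    suc j ℕ.* (suc (suc n) C suc j)
      ≡⟨ cong (suc j ℕ.*_) (pascal (suc n) j) ⟨
    suc j ℕ.* (suc n C j ℕ.+ suc n C suc j)
      ≡⟨ ℕ.*-distribˡ-+ (suc j) (suc n C j) (suc n C suc j) ⟩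
    suc j ℕ.* (suc n C j) ℕ.+ suc j ℕ.* (suc n C suc j)
      ≡⟨ cong (suc j ℕ.* (suc n C j) ℕ.+_) (C-absorb n j) ⟩
    suc j ℕ.* (suc n C j) ℕ.+ suc n ℕ.* (n C j)
      ≡⟨ merge j ⟩
    suc (suc n) ℕ.* (suc n C j) ∎
    where
    open ≡-Reasoning
    merge : ∀ j → suc j ℕ.* (suc n C j) ℕ.+ suc n ℕ.* (n C j) ≡ suc (suc n) ℕ.* (suc n C j)
    merge zero    = refl
    merge (suc j) = begin
      suc (suc j) ℕ.* c ℕ.+ suc n ℕ.* (n C suc j)
        ≡⟨ cong (λ x → c ℕ.+ x ℕ.+ suc n ℕ.* (n C suc j)) (C-absorb n j) ⟩
      c ℕ.+ suc n ℕ.* (n C j) ℕ.+ suc n ℕ.* (n C suc j)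
        ≡⟨ ℕ.+-assoc c _ _ ⟩
      c ℕ.+ (suc n ℕ.* (n C j) ℕ.+ suc n ℕ.* (n C suc j))
        ≡⟨ cong (c ℕ.+_) (ℕ.*-distribˡ-+ (suc n) (n C j) (n C suc j)) ⟨
      c ℕ.+ suc n ℕ.* (n C j ℕ.+ n C suc j)
        ≡⟨ cong (λ x → c ℕ.+ suc n ℕ.* x) (pascal n j) ⟩
      suc (suc n) ℕ.* c ∎
      where c = suc n C suc j

  altTerm : ℕ → (ℕ → ℤ) → ℕ → ℤ
  altTerm n f j = -1ℤ ^ j * + (n C j) * f j

  altBinomial : ℕ → (ℕ → ℤ) → ℤ
  altBinomial n f = ∑[ j < suc n ] altTerm n f (toℕ j)

  altBinomial-cong : ∀ n {f g} → (∀ j → f j ≡ g j) → altBinomial n f ≡ altBinomial n g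
  altBinomial-cong n {f} {g} f≗g =
    sum-cong-≗ {suc n} {altTerm n f ∘ toℕ} {altTerm n g ∘ toℕ}
               (λ j → cong (_*_ (-1ℤ ^ toℕ j * + (n C toℕ j))) (f≗g (toℕ j)))

  altTerm-suc : ∀ n f j → altTerm (suc n) f (suc j) ≡ - altTerm n (f ∘ suc) j + altTerm n f (suc j)
  altTerm-suc n f j = begin
    -1ℤ ^ suc j * + (suc n C suc j) * f (suc j)
      ≡⟨ cong (λ c → -1ℤ ^ suc j * + c * f (suc j)) (pascal n j) ⟨
    -1ℤ ^ suc j * + (n C j ℕ.+ n C suc j) * f (suc j)
      ≡⟨ cong₂ (λ s c → s * c * f (suc j)) (-1*i≡-i (-1ℤ ^ j)) (pos-+ (n C j) _) ⟩
    - (-1ℤ ^ j) * (+ (n C j) + + (n C suc j)) * f (suc j)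
      ≡⟨ split (-1ℤ ^ j) (+ (n C j)) _ (f (suc j)) ⟩
    - (-1ℤ ^ j * + (n C j) * f (suc j)) + - (-1ℤ ^ j) * + (n C suc j) * f (suc j)
      ≡⟨ cong (λ s → - altTerm n (f ∘ suc) j + s * + (n C suc j) * f (suc j)) (-1*i≡-i (-1ℤ ^ j)) ⟨
    - altTerm n (f ∘ suc) j + altTerm n f (suc j) ∎
    where
    open ≡-Reasoning
    split : ∀ s a b x → - s * (a + b) * x ≡ - (s * a * x) + - s * b * x
    split = solve-∀

  altBinomial-suc : ∀ n f → altBinomial (suc n) f ≡ altBinomial n f - altBinomial n (f ∘ suc)
  altBinomial-suc n f = begin
    altTerm (suc n) f 0 + ∑[ j < suc n ] altTerm (suc n) f (suc (toℕ j))
      ≡⟨ cong₂ _+_ (one-one (f 0)) (sum-cong-≗ {suc n} (altTerm-suc n f ∘ toℕ)) ⟩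
    f 0 + ∑[ j < suc n ] (- altTerm n (f ∘ suc) (toℕ j) + altTerm n f (suc (toℕ j)))
      ≡⟨ cong (_+_ (f 0)) (∑-distrib-+ {suc n} (λ j → - altTerm n (f ∘ suc) (toℕ j))
                                                 (altTerm n f ∘ suc ∘ toℕ)) ⟩
    f 0 + (∑[ j < suc n ] (- altTerm n (f ∘ suc) (toℕ j)) + ∑[ j < suc n ] altTerm n f (suc (toℕ j)))
      ≡⟨ cong₂ (λ x y → f 0 + (x + y)) (∑-neg {suc n} (altTerm n (f ∘ suc) ∘ toℕ))
                                       (∑ℕ-last n (altTerm n f ∘ suc)) ⟩
    f 0 + (- altBinomial n (f ∘ suc) + (rest + altTerm n f (suc n)))
      ≡⟨ cong (λ c → f 0 + (- altBinomial n (f ∘ suc) + (rest + -1ℤ ^ suc n * + c * f (suc n))))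
              (k>n⇒nCk≡0 (ℕ.n<1+n n)) ⟩
    f 0 + (- altBinomial n (f ∘ suc) + (rest + -1ℤ ^ suc n * 0ℤ * f (suc n)))
      ≡⟨ regroup (f 0) (altBinomial n (f ∘ suc)) rest (-1ℤ ^ suc n) (f (suc n)) ⟩
    f 0 + rest - altBinomial n (f ∘ suc)
      ≡⟨ cong (λ x → x + rest - altBinomial n (f ∘ suc)) (one-one (f 0)) ⟨
    altBinomial n f - altBinomial n (f ∘ suc)
      ∎
    where
    open ≡-Reasoning
    rest = ∑[ j < n ] altTerm n f (suc (toℕ j))
    one-one : ∀ x → 1ℤ * 1ℤ * x ≡ x
    one-one = solve-∀
    regroup : ∀ a b r s x → a + (- b + (r + s * 0ℤ * x)) ≡ a + r - b
    regroup = solve-∀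

  ∇^-expansion : ∀ n f t → ∇^ n f t ≡ altBinomial n (λ j → f (t ℕ.+ j))
  ∇^-expansion zero    f t = trans (cong f (sym (ℕ.+-identityʳ t))) (sym (unit (f (t ℕ.+ 0))))
    where
    unit : ∀ x → 1ℤ * 1ℤ * x + 0ℤ ≡ x
    unit = solve-∀
  ∇^-expansion (suc n) f t = begin
    ∇^ n f t - ∇^ n f (suc t)
      ≡⟨ cong₂ _-_ (∇^-expansion n f t) (∇^-expansion n f (suc t)) ⟩
    altBinomial n (λ j → f (t ℕ.+ j)) - altBinomial n (λ j → f (suc t ℕ.+ j))
      ≡⟨ cong (_-_ (altBinomial n (λ j → f (t ℕ.+ j)))) (altBinomial-cong n (λ j → cong f (ℕ.+-suc t j))) ⟨
    altBinomial n (λ j → f (t ℕ.+ j)) - altBinomial n (λ j → f (t ℕ.+ suc j))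
      ≡⟨ altBinomial-suc n (λ j → f (t ℕ.+ j)) ⟨
    altBinomial (suc n) (λ j → f (t ℕ.+ j)) ∎
    where open ≡-Reasoning

module Periodic (k : ℕ) where

  open import Data.Integer using (_+_; _*_; -_; _-_)
  open Sums
  open Differences

  -- Functions on ℤₚ are p-periodic functions ℕ → ℤ; k = p − 1 stands in for −1.
  p : ℕ
  p = suc k

  Periodic : (ℕ → ℤ) → Set
  Periodic f = ∀ t → f (t ℕ.+ p) ≡ f t

  Constant : (ℕ → ℤ) → Set
  Constant f = ∀ t → f t ≡ f 0

  total : (ℕ → ℤ) → ℤ
  total f = ∑[ s < p ] f (toℕ s)

  total-cong : ∀ {f g : ℕ → ℤ} → (∀ t → f t ≡ g t) → total f ≡ total g
  total-cong {f} {g} f≗g = sum-cong-≗ {p} {f ∘ toℕ} {g ∘ toℕ} (f≗g ∘ toℕ)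

  total-+ : ∀ f g → total (λ s → f s + g s) ≡ total f + total g
  total-+ f g = ∑-distrib-+ {p} (f ∘ toℕ) (g ∘ toℕ)

  total-- : ∀ f g → total (λ s → f s - g s) ≡ total f - total g
  total-- f g = ∑-distrib-- {p} (f ∘ toℕ) (g ∘ toℕ)

  total-*ˡ : ∀ c f → total (λ s → c * f s) ≡ c * total f
  total-*ˡ c f = sym (*-distribˡ-sum {p} c (f ∘ toℕ))

  periodic-shift : ∀ {f} → Periodic f → ∀ c → Periodic (λ s → f (s ℕ.+ c))
  periodic-shift {f} f-per c t = begin
    f (t ℕ.+ p ℕ.+ c)  ≡⟨ cong f (ℕ.+-assoc t p c) ⟩
    f (t ℕ.+ (p ℕ.+ c)) ≡⟨ cong (λ m → f (t ℕ.+ m)) (ℕ.+-comm p c) ⟩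
    f (t ℕ.+ (c ℕ.+ p)) ≡⟨ cong f (ℕ.+-assoc t c p) ⟨
    f (t ℕ.+ c ℕ.+ p)  ≡⟨ f-per (t ℕ.+ c) ⟩
    f (t ℕ.+ c)        ∎
    where open ≡-Reasoning

  total-suc : ∀ {f} → Periodic f → total (f ∘ suc) ≡ total f
  total-suc {f} f-per = begin
    total (f ∘ suc)                     ≡⟨ ∑ℕ-last k (f ∘ suc) ⟩
    ∑[ s < k ] f (suc (toℕ s)) + f p    ≡⟨ cong (_+_ (∑[ s < k ] f (suc (toℕ s)))) (f-per 0) ⟩
    ∑[ s < k ] f (suc (toℕ s)) + f 0    ≡⟨ +-comm _ (f 0) ⟩
    total f                             ∎
    where open ≡-Reasoning

  total-shift : ∀ {f} → Periodic f → ∀ c → total (λ s → f (s ℕ.+ c)) ≡ total f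
  total-shift {f} f-per zero    = total-cong (λ s → cong f (ℕ.+-identityʳ s))
  total-shift {f} f-per (suc c) = begin
    total (λ s → f (s ℕ.+ suc c))  ≡⟨ total-cong (λ s → cong f (ℕ.+-suc s c)) ⟩
    total (λ s → f (suc s ℕ.+ c))  ≡⟨ total-suc (periodic-shift f-per c) ⟩
    total (λ s → f (s ℕ.+ c))      ≡⟨ total-shift f-per c ⟩
    total f                        ∎
    where open ≡-Reasoning

  total-shiftˡ : ∀ {f} → Periodic f → ∀ c → total (λ s → f (c ℕ.+ s)) ≡ total f
  total-shiftˡ {f} f-per c = trans (total-cong (λ s → cong f (ℕ.+-comm c s))) (total-shift f-per c)

  periodic-+* : ∀ {f} → Periodic f → ∀ r q → f (r ℕ.+ q ℕ.* p) ≡ f r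
  periodic-+* {f} f-per r zero    = cong f (ℕ.+-identityʳ r)
  periodic-+* {f} f-per r (suc q) = begin
    f (r ℕ.+ (p ℕ.+ q ℕ.* p))  ≡⟨ cong (λ m → f (r ℕ.+ m)) (ℕ.+-comm p (q ℕ.* p)) ⟩
    f (r ℕ.+ (q ℕ.* p ℕ.+ p))  ≡⟨ cong f (ℕ.+-assoc r _ p) ⟨
    f (r ℕ.+ q ℕ.* p ℕ.+ p)    ≡⟨ f-per _ ⟩
    f (r ℕ.+ q ℕ.* p)          ≡⟨ periodic-+* f-per r q ⟩
    f r                        ∎
    where open ≡-Reasoning

  periodic-resp-% : ∀ {f} → Periodic f → ∀ {a b} → a % p ≡ b % p → f a ≡ f b
  periodic-resp-% {f} f-per {a} {b} a≡b = begin
    f a                          ≡⟨ cong f (m≡m%n+[m/n]*n a p) ⟩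
    f (a % p ℕ.+ (a / p) ℕ.* p)  ≡⟨ periodic-+* f-per _ (a / p) ⟩
    f (a % p)                    ≡⟨ cong f a≡b ⟩
    f (b % p)                    ≡⟨ periodic-+* f-per _ (b / p) ⟨
    f (b % p ℕ.+ (b / p) ℕ.* p)  ≡⟨ cong f (m≡m%n+[m/n]*n b p) ⟨
    f b                          ∎
    where open ≡-Reasoning

  total-constant : ∀ {f} → Constant f → total f ≡ + p * f 0
  total-constant {f} f-const = trans (total-cong f-const) (∑-const p (f 0))

  periodic-∇^ : ∀ i {f} → Periodic f → Periodic (∇^ i f)
  periodic-∇^ zero    f-per = f-per
  periodic-∇^ (suc i) f-per t = cong₂ _-_ (periodic-∇^ i f-per t) (periodic-∇^ i f-per (suc t))

  -- A ⋆ μ is the product A(x) · μ(x⁻¹) in ℤ[x]/(xᵖ − 1).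
  infixl 7 _⋆_

  _⋆_ : (ℕ → ℤ) → (ℕ → ℤ) → ℕ → ℤ
  (A ⋆ μ) t = total (λ s → μ s * A (t ℕ.+ s))

  ⋆-congˡ : ∀ {A B} μ → (∀ t → A t ≡ B t) → ∀ t → (A ⋆ μ) t ≡ (B ⋆ μ) t
  ⋆-congˡ μ A≗B t = total-cong (λ s → cong (_*_ (μ s)) (A≗B (t ℕ.+ s)))

  ⋆-congʳ : ∀ A {μ ν} → (∀ t → μ t ≡ ν t) → ∀ t → (A ⋆ μ) t ≡ (A ⋆ ν) t
  ⋆-congʳ A μ≗ν t = total-cong (λ s → cong (_* A (t ℕ.+ s)) (μ≗ν s))

  periodic-⋆ : ∀ {A} μ → Periodic A → Periodic (A ⋆ μ)
  periodic-⋆ {A} μ A-per t = total-cong (λ s → cong (_*_ (μ s)) (periodic-shift A-per s t))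

  ⋆-+ˡ : ∀ A B μ t → ((λ u → A u + B u) ⋆ μ) t ≡ (A ⋆ μ) t + (B ⋆ μ) t
  ⋆-+ˡ A B μ t = trans (total-cong (λ s → *-distribˡ-+ (μ s) (A (t ℕ.+ s)) (B (t ℕ.+ s))))
                       (total-+ (λ s → μ s * A (t ℕ.+ s)) (λ s → μ s * B (t ℕ.+ s)))

  ⋆-+ʳ : ∀ A μ ν t → (A ⋆ (λ u → μ u + ν u)) t ≡ (A ⋆ μ) t + (A ⋆ ν) t
  ⋆-+ʳ A μ ν t = trans (total-cong (λ s → *-distribʳ-+ (A (t ℕ.+ s)) (μ s) (ν s)))
                       (total-+ (λ s → μ s * A (t ℕ.+ s)) (λ s → ν s * A (t ℕ.+ s)))

  const-⋆ : ∀ c μ t → ((λ _ → c) ⋆ μ) t ≡ c * total μ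
  const-⋆ c μ t = trans (total-cong (λ s → *-comm (μ s) c)) (total-*ˡ c μ)

  ⋆-const : ∀ {A} c → Periodic A → ∀ t → (A ⋆ (λ _ → c)) t ≡ c * total A
  ⋆-const {A} c A-per t =
    trans (total-*ˡ c (λ s → A (t ℕ.+ s))) (cong (_*_ c) (total-shiftˡ A-per t))

  ∇-⋆ : ∀ A μ t → (∇ A ⋆ μ) t ≡ (A ⋆ μ) t - (A ⋆ μ) (suc t)
  ∇-⋆ A μ t = trans (total-cong (λ s → x[y-z]≈xy-xz (μ s) (A (t ℕ.+ s)) (A (suc t ℕ.+ s))))
                    (total-- (λ s → μ s * A (t ℕ.+ s)) (λ s → μ s * A (suc t ℕ.+ s)))

  ⋆-∇ : ∀ {A μ} → Periodic A → Periodic μ → ∀ t → (A ⋆ ∇ μ) t ≡ (A ⋆ μ) t - (A ⋆ μ) (t ℕ.+ k)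
  ⋆-∇ {A} {μ} A-per μ-per t = begin
    (A ⋆ ∇ μ) t
      ≡⟨ total-cong (λ s → [y-z]x≈yx-zx (A (t ℕ.+ s)) (μ s) (μ (suc s))) ⟩
    total (λ s → μ s * A (t ℕ.+ s) - μ (suc s) * A (t ℕ.+ s))
      ≡⟨ total-- (λ s → μ s * A (t ℕ.+ s)) (λ s → μ (suc s) * A (t ℕ.+ s)) ⟩
    (A ⋆ μ) t - total (λ s → μ (suc s) * A (t ℕ.+ s))
      ≡⟨ cong (_-_ ((A ⋆ μ) t)) (total-cong (λ s → cong (_*_ (μ (suc s))) (A-shift s))) ⟨
    (A ⋆ μ) t - total (λ s → μ (suc s) * A (t ℕ.+ k ℕ.+ suc s))
      ≡⟨ cong (_-_ ((A ⋆ μ) t)) (total-suc (λ u → cong₂ _*_ (μ-per u) (shifted-per u))) ⟩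
    (A ⋆ μ) t - (A ⋆ μ) (t ℕ.+ k)
      ∎
    where
    open ≡-Reasoning
    A-shift : ∀ s → A (t ℕ.+ k ℕ.+ suc s) ≡ A (t ℕ.+ s)
    A-shift s = trans (cong A (solve-+ t k s)) (A-per (t ℕ.+ s))
      where
      solve-+ : ∀ t k s → t ℕ.+ k ℕ.+ suc s ≡ t ℕ.+ s ℕ.+ suc k
      solve-+ = ℕSolver.solve-∀
    shifted-per : Periodic (λ s → A (t ℕ.+ k ℕ.+ s))
    shifted-per u = trans (cong A (sym (ℕ.+-assoc (t ℕ.+ k) u p))) (A-per _)

  total-⋆ : ∀ {A} μ → Periodic A → total (A ⋆ μ) ≡ total A * total μ
  total-⋆ {A} μ A-per = begin
    total (λ t → total (λ s → μ s * A (t ℕ.+ s)))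
      ≡⟨ ∑-comm {p} {p} (λ t s → μ (toℕ s) * A (toℕ t ℕ.+ toℕ s)) ⟩
    total (λ s → total (λ t → μ s * A (t ℕ.+ s)))
      ≡⟨ total-cong column ⟩
    total (λ s → total A * μ s)
      ≡⟨ total-*ˡ (total A) μ ⟩
    total A * total μ ∎
    where
    open ≡-Reasoning
    column : ∀ s → total (λ t → μ s * A (t ℕ.+ s)) ≡ total A * μ s
    column s = begin
      total (λ t → μ s * A (t ℕ.+ s))  ≡⟨ total-*ˡ (μ s) (λ t → A (t ℕ.+ s)) ⟩
      μ s * total (λ t → A (t ℕ.+ s))  ≡⟨ cong (_*_ (μ s)) (total-shift A-per s) ⟩
      μ s * total A                    ≡⟨ *-comm (μ s) (total A) ⟩
      total A * μ s                    ∎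

module Rigidity (m : ℕ) where

  open import Data.Integer using (_+_; _*_; -_; _-_; _^_)
  open Sums
  open Differences

  private
    k : ℕ
    k = 2 ℕ.* m

  open Periodic k

  ∇-preimage : ∀ {A c} → Periodic A → total A ≡ c * + p →
               Σ[ B ∈ (ℕ → ℤ) ] Periodic B × (∀ t → A t ≡ ∇ B t + c)
  ∇-preimage {A} {c} A-per total≡ = B , B-per , A≡
    where
    A₀ : ℕ → ℤ
    A₀ t = A t - c
    total-A₀ : total A₀ ≡ 0ℤ
    total-A₀ = begin
      total A₀                ≡⟨ total-- A (λ _ → c) ⟩
      total A - total (λ _ → c) ≡⟨ cong₂ _-_ total≡ (∑-const p c) ⟩
      c * + p - + p * c       ≡⟨ cong (_-_ (c * + p)) (*-comm (+ p) c) ⟩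
      c * + p - c * + p       ≡⟨ +-inverseʳ (c * + p) ⟩
      0ℤ                      ∎
      where open ≡-Reasoning
    B : ℕ → ℤ
    B t = - ∑[ s < t ] A₀ (toℕ s)
    B-per : Periodic B
    B-per t = cong -_ (begin
      ∑[ s < t ℕ.+ p ] A₀ (toℕ s)
        ≡⟨ ∑ℕ-split t p A₀ ⟩
      ∑[ s < t ] A₀ (toℕ s) + total (λ s → A₀ (t ℕ.+ s))
        ≡⟨ cong (_+_ S) (total-shiftˡ (λ u → cong (_- c) (A-per u)) t) ⟩
      ∑[ s < t ] A₀ (toℕ s) + total A₀
        ≡⟨ cong (_+_ S) total-A₀ ⟩
      ∑[ s < t ] A₀ (toℕ s) + 0ℤ
        ≡⟨ +-identityʳ S ⟩
      ∑[ s < t ] A₀ (toℕ s) ∎)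
      where
      open ≡-Reasoning
      S = ∑[ s < t ] A₀ (toℕ s)
    A≡ : ∀ t → A t ≡ ∇ B t + c
    A≡ t = trans (telescope (A t) c (∑[ s < t ] A₀ (toℕ s)))
                 (cong (λ x → - ∑[ s < t ] A₀ (toℕ s) - - x + c) (sym (∑ℕ-last t A₀)))
      where
      telescope : ∀ a c s → a ≡ - s - - (s + (a - c)) + c
      telescope = solve-∀

  periodic-∇-constant⇒constant : ∀ {X c} → Periodic X → (∀ t → ∇ X t ≡ c) → Constant X
  periodic-∇-constant⇒constant {X} {c} X-per ∇X≡c t = begin
    X t                 ≡⟨ linear t ⟩
    X 0 - + t * c       ≡⟨ cong (λ d → X 0 - + t * d) c≡0 ⟩
    X 0 - + t * 0ℤ      ≡⟨ cong (λ d → X 0 - d) (*-zeroʳ (+ t)) ⟩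
    X 0 - 0ℤ            ≡⟨ +-identityʳ (X 0) ⟩
    X 0                 ∎
    where
    open ≡-Reasoning
    cancel : ∀ a b → b ≡ a - (a - b)
    cancel = solve-∀
    linear : ∀ t → X t ≡ X 0 - + t * c
    linear zero    = sym (trans (cong (λ d → X 0 - d) (*-zeroˡ c)) (+-identityʳ (X 0)))
    linear (suc t) = begin
      X (suc t)                ≡⟨ cancel (X t) (X (suc t)) ⟩
      X t - ∇ X t              ≡⟨ cong (_-_ (X t)) (∇X≡c t) ⟩
      X t - c                  ≡⟨ cong (_- c) (linear t) ⟩
      X 0 - + t * c - c        ≡⟨ regroup (X 0) (+ t) c ⟩
      X 0 - (1ℤ + + t) * c     ∎
      where
      regroup : ∀ a t c → a - t * c - c ≡ a - (1ℤ + t) * c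
      regroup = solve-∀
    c≡0 : c ≡ 0ℤ
    c≡0 = *-cancelˡ-≡ (+ p) c 0ℤ (begin
      + p * c                        ≡⟨ cancel (X 0) (+ p * c) ⟩
      X 0 - (X 0 - + p * c)          ≡⟨ cong (λ d → X 0 - d) (trans (sym (linear p)) (X-per 0)) ⟩
      X 0 - X 0                      ≡⟨ +-inverseʳ (X 0) ⟩
      0ℤ                             ≡⟨ *-zeroʳ (+ p) ⟨
      + p * 0ℤ                       ∎)

  -- A is constant modulo the image of ∇ⁱ: in ℤ[x]/(xᵖ − 1) this is the ideal
  -- generated by (1 − x)ⁱ and 1 + x + ⋯ + xᵖ⁻¹.
  ∇-Divisible : ℕ → (ℕ → ℤ) → Set
  ∇-Divisible i A = Σ[ B ∈ (ℕ → ℤ) ] Periodic B × Σ[ c ∈ ℤ ] (∀ t → A t ≡ ∇^ i B t + c)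

  ∇-Divisible-zero : ∀ {A} → Periodic A → ∇-Divisible 0 A
  ∇-Divisible-zero {A} A-per = A , A-per , 0ℤ , λ t → sym (+-identityʳ (A t))

  ∇-Divisible-suc : ∀ {i A A₁ c} → (∀ t → A t ≡ ∇ A₁ t + c) →
                    ∇-Divisible i A₁ → ∇-Divisible (suc i) A
  ∇-Divisible-suc {i} {A} {A₁} {c} A≡ (B , B-per , c₁ , A₁≡) = B , B-per , c , λ t → begin
    A t                                          ≡⟨ A≡ t ⟩
    A₁ t - A₁ (suc t) + c                        ≡⟨ cong₂ (λ x y → x - y + c) (A₁≡ t) (A₁≡ (suc t)) ⟩
    ∇^ i B t + c₁ - (∇^ i B (suc t) + c₁) + c    ≡⟨ drop-c₁ (∇^ i B t) (∇^ i B (suc t)) c₁ c ⟩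
    ∇^ (suc i) B t + c                           ∎
    where
    open ≡-Reasoning
    drop-c₁ : ∀ a b c₁ c → a + c₁ - (b + c₁) + c ≡ a - b + c
    drop-c₁ = solve-∀

  ∇-Divisible-≤ : ∀ {i j A} → j ℕ.≤ i → ∇-Divisible i A → ∇-Divisible j A
  ∇-Divisible-≤ {i} {j} j≤i (B , B-per , c , A≡) =
    ∇^ (i ℕ.∸ j) B , periodic-∇^ (i ℕ.∸ j) B-per , c , λ t → begin
      _                                ≡⟨ A≡ t ⟩
      ∇^ i B t + c                     ≡⟨ cong (λ l → ∇^ l B t + c) (ℕ.m+[n∸m]≡n j≤i) ⟨
      ∇^ (j ℕ.+ (i ℕ.∸ j)) B t + c     ≡⟨ cong (_+ c) (∇^-+ j (i ℕ.∸ j) B t) ⟩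
      ∇^ j (∇^ (i ℕ.∸ j) B) t + c      ∎
    where open ≡-Reasoning

  ⋆-constant-peelˡ : ∀ {A A₁ μ c} → Periodic A₁ → (∀ t → A t ≡ ∇ A₁ t + c) →
                     Constant (A ⋆ μ) → Constant (A₁ ⋆ μ)
  ⋆-constant-peelˡ {A} {A₁} {μ} {c} A₁-per A≡ A⋆μ-const =
    periodic-∇-constant⇒constant (periodic-⋆ μ A₁-per) λ t → begin
      ∇ (A₁ ⋆ μ) t                                     ≡⟨ ∇-⋆ A₁ μ t ⟨
      (∇ A₁ ⋆ μ) t                                     ≡⟨ add-sub ((∇ A₁ ⋆ μ) t) d ⟩
      (∇ A₁ ⋆ μ) t + d - d                             ≡⟨ cong (λ x → (∇ A₁ ⋆ μ) t + x - d) (const-⋆ c μ t) ⟨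
      (∇ A₁ ⋆ μ) t + ((λ _ → c) ⋆ μ) t - d             ≡⟨ cong (_- d) (⋆-+ˡ (∇ A₁) (λ _ → c) μ t) ⟨
      ((λ u → ∇ A₁ u + c) ⋆ μ) t - d                   ≡⟨ cong (_- d) (⋆-congˡ μ A≡ t) ⟨
      (A ⋆ μ) t - d                                    ≡⟨ cong (_- d) (A⋆μ-const t) ⟩
      (A ⋆ μ) 0 - d                                    ∎
    where
    open ≡-Reasoning
    d = c * total μ
    add-sub : ∀ a b → a ≡ a + b - b
    add-sub = solve-∀

  ⋆-constant-peelʳ : ∀ {A μ μ₁ c} → Periodic A → Periodic μ₁ → (∀ t → μ t ≡ ∇ μ₁ t + c) →
                     Constant (A ⋆ μ) → Constant (A ⋆ μ₁)
  ⋆-constant-peelʳ {A} {μ} {μ₁} {c} A-per μ₁-per μ≡ A⋆μ-const =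
    periodic-∇-constant⇒constant X-per λ t → begin
      X t - X (suc t)                         ≡⟨ cong (_- X (suc t)) (X-per′ t) ⟩
      X (suc t ℕ.+ k) - X (suc t)             ≡⟨ neg-sub (X (suc t)) (X (suc t ℕ.+ k)) ⟩
      - (X (suc t) - X (suc t ℕ.+ k))         ≡⟨ cong -_ (gap (suc t)) ⟩
      - ((A ⋆ μ) 0 - d)                       ∎
    where
    open ≡-Reasoning
    X = A ⋆ μ₁
    d = c * total A
    X-per : Periodic X
    X-per = periodic-⋆ μ₁ A-per
    X-per′ : ∀ t → X t ≡ X (suc t ℕ.+ k)
    X-per′ t = sym (trans (cong X (sym (ℕ.+-suc t k))) (X-per t))
    neg-sub : ∀ a b → b - a ≡ - (a - b)
    neg-sub = solve-∀
    add-sub : ∀ a b → a ≡ a + b - b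
    add-sub = solve-∀
    gap : ∀ t → X t - X (t ℕ.+ k) ≡ (A ⋆ μ) 0 - d
    gap t = begin
      X t - X (t ℕ.+ k)                        ≡⟨ ⋆-∇ A-per μ₁-per t ⟨
      (A ⋆ ∇ μ₁) t                             ≡⟨ add-sub ((A ⋆ ∇ μ₁) t) d ⟩
      (A ⋆ ∇ μ₁) t + d - d                     ≡⟨ cong (λ x → (A ⋆ ∇ μ₁) t + x - d) (⋆-const c A-per t) ⟨
      (A ⋆ ∇ μ₁) t + (A ⋆ (λ _ → c)) t - d     ≡⟨ cong (_- d) (⋆-+ʳ A (∇ μ₁) (λ _ → c) t) ⟨
      (A ⋆ (λ u → ∇ μ₁ u + c)) t - d           ≡⟨ cong (_- d) (⋆-congʳ A μ≡ t) ⟨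
      (A ⋆ μ) t - d                            ≡⟨ cong (_- d) (A⋆μ-const t) ⟩
      (A ⋆ μ) 0 - d                            ∎

  -1^p≡-1 : -1ℤ ^ p ≡ -1ℤ
  -1^p≡-1 = cong (-1ℤ *_) (trans (sym (^-*-assoc -1ℤ 2 m)) (^-zeroˡ m))

  module _ (p-prime : Prime p) where

    p∣*⇒p∣⊎p∣ : ∀ {x y} → + p ∣ x * y → (+ p ∣ x) ⊎ (+ p ∣ y)
    p∣*⇒p∣⊎p∣ {x} {y} p∣xy
      with euclidsLemma ∣ x ∣ ∣ y ∣ p-prime (subst (p ℕ.∣_) (abs-* x y) (∣⇒∣ᵤ p∣xy))
    ... | inj₁ p∣x = inj₁ (∣ᵤ⇒∣ p∣x)
    ... | inj₂ p∣y = inj₂ (∣ᵤ⇒∣ p∣y)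

    -- p divides total (A ⋆ μ) = total A * total μ, so ∇ can be split off A or μ; doing so
    -- keeps the correlation constant.
    ⋆-constant⇒∇-Divisible : ∀ n {A μ} → Periodic A → Periodic μ → Constant (A ⋆ μ) →
      Σ[ i ∈ ℕ ] Σ[ j ∈ ℕ ] i ℕ.+ j ≡ n × ∇-Divisible i A × ∇-Divisible j μ
    ⋆-constant⇒∇-Divisible zero A-per μ-per _ =
      0 , 0 , refl , ∇-Divisible-zero A-per , ∇-Divisible-zero μ-per
    ⋆-constant⇒∇-Divisible (suc n) {A} {μ} A-per μ-per A⋆μ-const with p∣*⇒p∣⊎p∣ p∣total
      where
      p∣total : + p ∣ total A * total μ
      p∣total = divides ((A ⋆ μ) 0) (begin
        total A * total μ    ≡⟨ total-⋆ μ A-per ⟨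
        total (A ⋆ μ)        ≡⟨ total-constant A⋆μ-const ⟩
        + p * (A ⋆ μ) 0      ≡⟨ *-comm (+ p) _ ⟩
        (A ⋆ μ) 0 * + p      ∎)
        where open ≡-Reasoning
    ... | inj₁ (divides c total≡) =
      let A₁ , A₁-per , A≡ = ∇-preimage {A} {c} A-per total≡
          i , j , i+j≡n , A₁-div , μ-div =
            ⋆-constant⇒∇-Divisible n A₁-per μ-per
              (⋆-constant-peelˡ {A} {A₁} {μ} {c} A₁-per A≡ A⋆μ-const)
      in suc i , j , cong suc i+j≡n , ∇-Divisible-suc {i} A≡ A₁-div , μ-div
    ... | inj₂ (divides c total≡) =
      let μ₁ , μ₁-per , μ≡ = ∇-preimage {μ} {c} μ-per total≡
          i , j , i+j≡n , A-div , μ₁-div =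
            ⋆-constant⇒∇-Divisible n A-per μ₁-per
              (⋆-constant-peelʳ {A} {μ} {μ₁} {c} A-per μ₁-per μ≡ A⋆μ-const)
      in i , suc j , trans (ℕ.+-suc i j) (cong suc i+j≡n) , A-div , ∇-Divisible-suc {j} μ≡ μ₁-div

    ⋆-constant⇒∇-Divisible-either : ∀ n {A μ} → Periodic A → Periodic μ → Constant (A ⋆ μ) →
                                    ∇-Divisible n A ⊎ ∇-Divisible n μ
    ⋆-constant⇒∇-Divisible-either n A-per μ-per A⋆μ-const
      with i , j , i+j≡ , A-div , μ-div ← ⋆-constant⇒∇-Divisible (n ℕ.+ n) A-per μ-per A⋆μ-const
      with ℕ.≤-total n i
    ... | inj₁ n≤i = inj₁ (∇-Divisible-≤ n≤i A-div)
    ... | inj₂ i≤n = inj₂ (∇-Divisible-≤ n≤j μ-div)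
      where
      n≤j : n ℕ.≤ j
      n≤j = ℕ.+-cancelˡ-≤ n n j (subst (ℕ._≤ n ℕ.+ j) i+j≡ (ℕ.+-monoˡ-≤ j i≤n))

    p∣pC[1+j] : ∀ j → j ℕ.< k → p ℕ.∣ p C suc j
    p∣pC[1+j] j j<k with euclidsLemma (suc j) (p C suc j) p-prime
                           (ℕ.divides (k C j) (trans (C-absorb k j) (ℕ.*-comm p (k C j))))
    ... | inj₁ p∣1+j = contradiction (ℕ.∣⇒≤ p∣1+j) (ℕ.<⇒≱ (ℕ.s≤s j<k))
    ... | inj₂ p∣C   = p∣C

    ∇^p/p : (ℕ → ℤ) → ℕ → ℤ
    ∇^p/p f t = ∑[ j < k ] (-1ℤ ^ suc (toℕ j) * + ((p C suc (toℕ j)) ℕ./ p) * f (t ℕ.+ suc (toℕ j)))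

    periodic-∇^p/p : ∀ {f} → Periodic f → Periodic (∇^p/p f)
    periodic-∇^p/p {f} f-per t = sum-cong-≗ {k} λ j →
      cong (_*_ (-1ℤ ^ suc (toℕ j) * + ((p C suc (toℕ j)) ℕ./ p))) (periodic-shift f-per (suc (toℕ j)) t)

    ∑-inner-altTerm : ∀ f t → ∑[ j < k ] altTerm p (λ u → f (t ℕ.+ u)) (suc (toℕ j)) ≡ + p * ∇^p/p f t
    ∑-inner-altTerm f t = trans (sum-cong-≗ {k} (λ j → pull-p (Fin.toℕ<n j)))
      (sym (*-distribˡ-sum {k} (+ p) (λ j → -1ℤ ^ suc (toℕ j) * + q (toℕ j) * f (t ℕ.+ suc (toℕ j)))))
      where
      q : ℕ → ℕ
      q j = (p C suc j) ℕ./ p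
      reassoc : ∀ s a b x → s * (a * b) * x ≡ a * (s * b * x)
      reassoc = solve-∀
      pull-p : ∀ {j} → j ℕ.< k →
               altTerm p (λ u → f (t ℕ.+ u)) (suc j) ≡ + p * (-1ℤ ^ suc j * + q j * f (t ℕ.+ suc j))
      pull-p {j} j<k = begin
        -1ℤ ^ suc j * + (p C suc j) * x
          ≡⟨ cong (λ c → -1ℤ ^ suc j * + c * x) (m*[n/m]≡n (p∣pC[1+j] j j<k)) ⟨
        -1ℤ ^ suc j * + (p ℕ.* q j) * x
          ≡⟨ cong (λ c → -1ℤ ^ suc j * c * x) (pos-* p (q j)) ⟩
        -1ℤ ^ suc j * (+ p * + q j) * x
          ≡⟨ reassoc (-1ℤ ^ suc j) (+ p) (+ q j) x ⟩
        + p * (-1ℤ ^ suc j * + q j * x) ∎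
        where
        open ≡-Reasoning
        x = f (t ℕ.+ suc j)

    -- (1 − x)ᵖ = 1 − xᵖ + p · (…), and xᵖ = 1 on periodic functions.
    ∇^p≡p*∇^p/p : ∀ {f} → Periodic f → ∀ t → ∇^ p f t ≡ + p * ∇^p/p f t
    ∇^p≡p*∇^p/p {f} f-per t = begin
      ∇^ p f t
        ≡⟨ ∇^-expansion p f t ⟩
      altTerm p g 0 + ∑[ j < p ] altTerm p g (suc (toℕ j))
        ≡⟨ cong (_+_ (altTerm p g 0)) (∑ℕ-last k (altTerm p g ∘ suc)) ⟩
      altTerm p g 0 + (∑[ j < k ] altTerm p g (suc (toℕ j)) + altTerm p g p)
        ≡⟨ cong₂ (λ x y → altTerm p g 0 + (x + y)) (∑-inner-altTerm f t) last ⟩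
      altTerm p g 0 + (+ p * ∇^p/p f t + - f t)
        ≡⟨ cong (λ x → 1ℤ * 1ℤ * f x + (+ p * ∇^p/p f t + - f t)) (ℕ.+-identityʳ t) ⟩
      1ℤ * 1ℤ * f t + (+ p * ∇^p/p f t + - f t)
        ≡⟨ cancel (f t) (+ p * ∇^p/p f t) ⟩
      + p * ∇^p/p f t ∎
      where
      open ≡-Reasoning
      g : ℕ → ℤ
      g j = f (t ℕ.+ j)
      cancel : ∀ x y → 1ℤ * 1ℤ * x + (y + - x) ≡ y
      cancel = solve-∀
      last : altTerm p g p ≡ - f t
      last = begin
        -1ℤ ^ p * + (p C p) * f (t ℕ.+ p)   ≡⟨ cong₂ (λ s c → s * + c * f (t ℕ.+ p)) -1^p≡-1 (nCn≡1 p) ⟩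
        -1ℤ * 1ℤ * f (t ℕ.+ p)              ≡⟨ cong (λ x → -1ℤ * 1ℤ * x) (f-per t) ⟩
        -1ℤ * 1ℤ * f t                      ≡⟨ -1*i≡-i (f t) ⟩
        - f t                               ∎

    ∇^pK-factor : ∀ K {f} → Periodic f →
                  Σ[ Y ∈ (ℕ → ℤ) ] Periodic Y × (∀ t → ∇^ (p ℕ.* K) f t ≡ + (p ℕ.^ K) * Y t)
    ∇^pK-factor zero    {f} f-per =
      f , f-per , λ t → trans (cong (λ i → ∇^ i f t) (ℕ.*-zeroʳ p)) (sym (*-identityˡ (f t)))
    ∇^pK-factor (suc K) {f} f-per =
      let Y₁ , Y₁-per , ∇^pK≡ = ∇^pK-factor K f-per
      in ∇^p/p Y₁ , periodic-∇^p/p Y₁-per , λ t → begin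
        ∇^ (p ℕ.* suc K) f t
          ≡⟨ cong (λ i → ∇^ i f t) (ℕ.*-suc p K) ⟩
        ∇^ (p ℕ.+ p ℕ.* K) f t
          ≡⟨ ∇^-+ p (p ℕ.* K) f t ⟩
        ∇^ p (∇^ (p ℕ.* K) f) t
          ≡⟨ ∇^-cong p ∇^pK≡ t ⟩
        ∇^ p (λ u → P * Y₁ u) t
          ≡⟨ ∇^-*ˡ p P Y₁ t ⟩
        P * ∇^ p Y₁ t
          ≡⟨ cong (_*_ P) (∇^p≡p*∇^p/p Y₁-per t) ⟩
        P * (+ p * ∇^p/p Y₁ t)
          ≡⟨ *-assoc P (+ p) (∇^p/p Y₁ t) ⟨
        P * + p * ∇^p/p Y₁ t
          ≡⟨ cong (_* ∇^p/p Y₁ t) (trans (*-comm P (+ p)) (sym (pos-* p (p ℕ.^ K)))) ⟩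
        + (p ℕ.^ suc K) * ∇^p/p Y₁ t ∎
      where
      open ≡-Reasoning
      P = + (p ℕ.^ K)

    ∇-Divisible⇒p^K∣ : ∀ K {A} → ∇-Divisible (p ℕ.* K) A → ∀ t → + (p ℕ.^ K) ∣ A t - A 0
    ∇-Divisible⇒p^K∣ K {A} (B , B-per , c , A≡) t with Y , _ , ∇^pK≡ ← ∇^pK-factor K B-per =
      divides (Y t - Y 0) (begin
        A t - A 0
          ≡⟨ cong₂ _-_ (A≡ t) (A≡ 0) ⟩
        ∇^ (p ℕ.* K) B t + c - (∇^ (p ℕ.* K) B 0 + c)
          ≡⟨ cong₂ (λ x y → x + c - (y + c)) (∇^pK≡ t) (∇^pK≡ 0) ⟩
        P * Y t + c - (P * Y 0 + c)
          ≡⟨ factor P (Y t) (Y 0) c ⟩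
        (Y t - Y 0) * P ∎)
      where
      open ≡-Reasoning
      P = + (p ℕ.^ K)
      factor : ∀ a x y c → a * x + c - (a * y + c) ≡ (x - y) * a
      factor = solve-∀

    n<p^n : ∀ n → n ℕ.< p ℕ.^ n
    n<p^n zero    = ℕ.s≤s ℕ.z≤n
    n<p^n (suc n) = subst (ℕ._≤ p ℕ.^ suc n) (ℕ.+-comm (suc n) 1)
                      (ℕ.+-mono-≤ (n<p^n n) (ℕ.*-mono-≤ 1≤k (ℕ.m^n>0 p n)))
      where
      1≤k : 1 ℕ.≤ k
      1≤k = ℕ.≤-pred (ℕ.nonTrivial⇒n>1 p {{prime⇒nonTrivial {p} p-prime}})

    -- Constants are the multiples of 1 + x + ⋯ + xᵖ⁻¹, so this says that ℤ[ζₚ] has no zero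
    -- divisors. K exceeds both differences below, and either alternative (with n = p·K)
    -- makes one of them divisible by pᴷ, hence zero.
    ⋆-constant⇒constant : ∀ {A μ} → Periodic A → Periodic μ → Constant (A ⋆ μ) →
                          total μ ≢ + p * μ 0 → Constant A
    ⋆-constant⇒constant {A} {μ} A-per μ-per A⋆μ-const total≢ t =
      [ A-case , μ-case ] (⋆-constant⇒∇-Divisible-either (p ℕ.* K) A-per μ-per A⋆μ-const)
      where
      K = ∣ A t - A 0 ∣ ℕ.+ ∣ total μ - + p * μ 0 ∣
      A-case : ∇-Divisible (p ℕ.* K) A → A t ≡ A 0
      A-case A-div = i-j≡0⇒i≡j (A t) (A 0) (small-multiple≡0 (∇-Divisible⇒p^K∣ K A-div t)
                       (ℕ.≤-<-trans (ℕ.m≤m+n _ _) (n<p^n K)))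
      μ-case : ∇-Divisible (p ℕ.* K) μ → A t ≡ A 0
      μ-case μ-div = contradiction (i-j≡0⇒i≡j (total μ) (+ p * μ 0) (small-multiple≡0 p^K∣
                       (ℕ.≤-<-trans (ℕ.m≤n+m _ _) (n<p^n K)))) total≢
        where
        p^K∣ : + (p ℕ.^ K) ∣ total μ - + p * μ 0
        p^K∣ = subst (+ (p ℕ.^ K) ∣_)
                 (trans (total-- μ (λ _ → μ 0)) (cong (_-_ (total μ)) (∑-const p (μ 0))))
                 (∣-sum {n = p} (∇-Divisible⇒p^K∣ K μ-div ∘ toℕ))

module Residues (k : ℕ) where

  open import Data.Integer using (_+_; _*_; -_; _-_)
  open Sums
  open Periodic k

  infix 4 _≡ₚ_

  -- A record rather than a % p ≡ b % p, so that a and b can be inferred from a proof.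
  record _≡ₚ_ (a b : ℕ) : Set where
    constructor mk≡ₚ
    field %≡% : a % p ≡ b % p
  open _≡ₚ_ public

  ≡ₚ-refl : ∀ {a} → a ≡ₚ a
  ≡ₚ-refl = mk≡ₚ refl

  ≡ₚ-sym : ∀ {a b} → a ≡ₚ b → b ≡ₚ a
  ≡ₚ-sym (mk≡ₚ e) = mk≡ₚ (sym e)

  ≡ₚ-trans : ∀ {a b c} → a ≡ₚ b → b ≡ₚ c → a ≡ₚ c
  ≡ₚ-trans (mk≡ₚ e) (mk≡ₚ f) = mk≡ₚ (trans e f)

  ≡ₚ-setoid : Setoid 0ℓ 0ℓ
  ≡ₚ-setoid = record
    { Carrier       = ℕ
    ; _≈_           = _≡ₚ_
    ; isEquivalence = record { refl = ≡ₚ-refl ; sym = ≡ₚ-sym ; trans = ≡ₚ-trans }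
    }

  module ≡ₚ-Reasoning = SetoidReasoning ≡ₚ-setoid

  ≡⇒≡ₚ : ∀ {a b} → a ≡ b → a ≡ₚ b
  ≡⇒≡ₚ refl = ≡ₚ-refl

  +-congₚ : ∀ {a a′ b b′} → a ≡ₚ a′ → b ≡ₚ b′ → a ℕ.+ b ≡ₚ a′ ℕ.+ b′
  +-congₚ {a} {a′} {b} {b′} (mk≡ₚ e) (mk≡ₚ f) =
    mk≡ₚ (trans (%-distribˡ-+ a b p) (trans (cong₂ (λ x y → (x ℕ.+ y) % p) e f) (sym (%-distribˡ-+ a′ b′ p))))

  *-congₚ : ∀ {a a′ b b′} → a ≡ₚ a′ → b ≡ₚ b′ → a ℕ.* b ≡ₚ a′ ℕ.* b′
  *-congₚ {a} {a′} {b} {b′} (mk≡ₚ e) (mk≡ₚ f) =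
    mk≡ₚ (trans (%-distribˡ-* a b p) (trans (cong₂ (λ x y → (x ℕ.* y) % p) e f) (sym (%-distribˡ-* a′ b′ p))))

  %≡ₚ : ∀ a → a % p ≡ₚ a
  %≡ₚ a = mk≡ₚ (m%n%n≡m%n a p)

  +*p≡ₚ : ∀ a b → a ℕ.+ b ℕ.* p ≡ₚ a
  +*p≡ₚ a b = mk≡ₚ ([m+kn]%n≡m%n a b p)

  +p≡ₚ : ∀ a → a ℕ.+ p ≡ₚ a
  +p≡ₚ a = ≡ₚ-trans (≡⇒≡ₚ (cong (a ℕ.+_) (sym (ℕ.*-identityˡ p)))) (+*p≡ₚ a 1)

  -- k ≡ -1, so adding x * k undoes adding x
  +-cancelʳₚ : ∀ a b x → a ℕ.+ x ≡ₚ b ℕ.+ x → a ≡ₚ b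
  +-cancelʳₚ a b x a+x≡b+x = begin
    a                       ≈⟨ +*p≡ₚ a x ⟨
    a ℕ.+ x ℕ.* p           ≡⟨ regroup a x ⟩
    a ℕ.+ x ℕ.+ x ℕ.* k     ≈⟨ +-congₚ a+x≡b+x (≡ₚ-refl {x ℕ.* k}) ⟩
    b ℕ.+ x ℕ.+ x ℕ.* k     ≡⟨ regroup b x ⟨
    b ℕ.+ x ℕ.* p           ≈⟨ +*p≡ₚ b x ⟩
    b                       ∎
    where
    open ≡ₚ-Reasoning
    regroup : ∀ a x → a ℕ.+ x ℕ.* suc k ≡ a ℕ.+ x ℕ.+ x ℕ.* k
    regroup a x = trans (cong (a ℕ.+_) (ℕ.*-suc x k)) (sym (ℕ.+-assoc a x (x ℕ.* k)))

  <p⇒≡ₚ⇒≡ : ∀ {a b} → a ℕ.< p → b ℕ.< p → a ≡ₚ b → a ≡ b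
  <p⇒≡ₚ⇒≡ a<p b<p (mk≡ₚ e) = trans (sym (m<n⇒m%n≡m a<p)) (trans e (m<n⇒m%n≡m b<p))

  k*k≡ₚ1 : ∀ c → c ℕ.* k ℕ.* k ≡ₚ c
  k*k≡ₚ1 c = +-cancelʳₚ (c ℕ.* k ℕ.* k) c (c ℕ.* k) (begin
    c ℕ.* k ℕ.* k ℕ.+ c ℕ.* k    ≡⟨ expand₁ c k ⟩
    0 ℕ.+ c ℕ.* k ℕ.* p          ≈⟨ +*p≡ₚ 0 (c ℕ.* k) ⟩
    0                            ≈⟨ +*p≡ₚ 0 c ⟨
    0 ℕ.+ c ℕ.* p                ≡⟨ expand₂ c k ⟩
    c ℕ.+ c ℕ.* k                ∎)
    where
    open ≡ₚ-Reasoning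
    expand₁ : ∀ c k → c ℕ.* k ℕ.* k ℕ.+ c ℕ.* k ≡ 0 ℕ.+ c ℕ.* k ℕ.* (1 ℕ.+ k)
    expand₁ = ℕSolver.solve-∀
    expand₂ : ∀ c k → 0 ℕ.+ c ℕ.* (1 ℕ.+ k) ≡ c ℕ.+ c ℕ.* k
    expand₂ = ℕSolver.solve-∀

  toℕ-injectiveₚ : ∀ {a b : Fin p} → toℕ a ≡ₚ toℕ b → a ≡ b
  toℕ-injectiveₚ {a} {b} = Fin.toℕ-injective ∘ <p⇒≡ₚ⇒≡ (Fin.toℕ<n a) (Fin.toℕ<n b)

  toℕ-mod : ∀ m → toℕ (m mod p) ≡ₚ m
  toℕ-mod m = ≡ₚ-trans (≡⇒≡ₚ (Fin.toℕ-fromℕ< (m%n<n m p))) (%≡ₚ m)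

  mod-toℕ : ∀ (a : Fin p) → toℕ a mod p ≡ a
  mod-toℕ a = toℕ-injectiveₚ (toℕ-mod (toℕ a))

  ∑-translate : ∀ (σ : Fin p → Fin p) c → (∀ a → toℕ (σ a) ≡ₚ toℕ a ℕ.+ c) →
                ∀ g → ∑[ a < p ] g (σ a) ≡ sum g
  ∑-translate σ c σ≡ g = begin
    ∑[ a < p ] g (σ a)            ≡⟨ sum-cong-≗ {p} (λ a → cong g (toℕ-injectiveₚ
                                       (≡ₚ-trans (σ≡ a) (≡ₚ-sym (toℕ-mod (toℕ a ℕ.+ c)))))) ⟩
    total (λ s → G (s ℕ.+ c))     ≡⟨ total-shift G-per c ⟩
    total G                       ≡⟨ sum-cong-≗ {p} (cong g ∘ mod-toℕ) ⟩
    sum g                         ∎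
    where
    open ≡-Reasoning
    G : ℕ → ℤ
    G t = g (t mod p)
    G-per : Periodic G
    G-per t = cong g (toℕ-injectiveₚ
      (≡ₚ-trans (toℕ-mod (t ℕ.+ p)) (≡ₚ-trans (+p≡ₚ t) (≡ₚ-sym (toℕ-mod t)))))

  predMod : Fin p → Fin p
  predMod a = (toℕ a ℕ.+ k) mod p

  sucMod≡ₚ : ∀ a → toℕ (sucMod a) ≡ₚ toℕ a ℕ.+ 1
  sucMod≡ₚ a = ≡ₚ-trans (toℕ-mod (suc (toℕ a))) (≡⇒≡ₚ (ℕ.+-comm 1 (toℕ a)))

  predMod≡ₚ : ∀ a → toℕ (predMod a) ≡ₚ toℕ a ℕ.+ k
  predMod≡ₚ a = toℕ-mod (toℕ a ℕ.+ k)

  sucMod∘predMod : ∀ a → sucMod (predMod a) ≡ a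
  sucMod∘predMod a = toℕ-injectiveₚ (begin
    toℕ (sucMod (predMod a))   ≈⟨ sucMod≡ₚ (predMod a) ⟩
    toℕ (predMod a) ℕ.+ 1      ≈⟨ +-congₚ (predMod≡ₚ a) (≡ₚ-refl {1}) ⟩
    toℕ a ℕ.+ k ℕ.+ 1          ≡⟨ ℕ.+-assoc (toℕ a) k 1 ⟩
    toℕ a ℕ.+ (k ℕ.+ 1)        ≡⟨ cong (toℕ a ℕ.+_) (ℕ.+-comm k 1) ⟩
    toℕ a ℕ.+ p                ≈⟨ +p≡ₚ (toℕ a) ⟩
    toℕ a                      ∎)
    where open ≡ₚ-Reasoning

  predMod∘sucMod : ∀ a → predMod (sucMod a) ≡ a
  predMod∘sucMod a = toℕ-injectiveₚ (begin
    toℕ (predMod (sucMod a))   ≈⟨ predMod≡ₚ (sucMod a) ⟩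
    toℕ (sucMod a) ℕ.+ k       ≈⟨ +-congₚ (sucMod≡ₚ a) (≡ₚ-refl {k}) ⟩
    toℕ a ℕ.+ 1 ℕ.+ k          ≡⟨ ℕ.+-assoc (toℕ a) 1 k ⟩
    toℕ a ℕ.+ p                ≈⟨ +p≡ₚ (toℕ a) ⟩
    toℕ a                      ∎)
    where open ≡ₚ-Reasoning

  translations-differ : ∀ {σ τ : Fin p → Fin p} {c d} → c ℕ.< p → d ℕ.< p → c ≢ d →
                        (∀ a → toℕ (σ a) ≡ₚ toℕ a ℕ.+ c) → (∀ a → toℕ (τ a) ≡ₚ toℕ a ℕ.+ d) →
                        ∀ a → σ a ≢ τ a
  translations-differ {σ} {τ} {c} {d} c<p d<p c≢d σ≡ τ≡ a σa≡τa = c≢d (<p⇒≡ₚ⇒≡ c<p d<p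
    (+-cancelʳₚ c d (toℕ a) (begin
      c ℕ.+ toℕ a      ≡⟨ ℕ.+-comm c (toℕ a) ⟩
      toℕ a ℕ.+ c      ≈⟨ σ≡ a ⟨
      toℕ (σ a)        ≡⟨ cong toℕ σa≡τa ⟩
      toℕ (τ a)        ≈⟨ τ≡ a ⟩
      toℕ a ℕ.+ d      ≡⟨ ℕ.+-comm (toℕ a) d ⟩
      d ℕ.+ toℕ a      ∎)))
    where open ≡ₚ-Reasoning

  translate-0 : ∀ (a : Fin p) → toℕ a ≡ₚ toℕ a ℕ.+ 0
  translate-0 a = ≡⇒≡ₚ (sym (ℕ.+-identityʳ (toℕ a)))

  sucMod≢id : 0 ℕ.< k → ∀ a → sucMod a ≢ a
  sucMod≢id 0<k = translations-differ (ℕ.s≤s 0<k) (ℕ.s≤s ℕ.z≤n) (λ ()) sucMod≡ₚ translate-0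

  predMod≢id : 0 ℕ.< k → ∀ a → predMod a ≢ a
  predMod≢id 0<k =
    translations-differ (ℕ.n<1+n k) (ℕ.s≤s ℕ.z≤n) (ℕ.<⇒≢ 0<k ∘ sym) predMod≡ₚ translate-0

  sucMod≢predMod : 2 ℕ.≤ k → ∀ a → sucMod a ≢ predMod a
  sucMod≢predMod 2≤k =
    translations-differ (ℕ.s≤s (ℕ.<-trans ℕ.z<s 2≤k)) (ℕ.n<1+n k) (ℕ.<⇒≢ 2≤k) sucMod≡ₚ predMod≡ₚ

  δ : ℕ → ℤ
  δ t = 𝟙 (t % p ℕ.≟ 0)

  δ-nonneg : ∀ t → 0ℤ ≤ δ t
  δ-nonneg t = bit⇒nonneg (𝟙-bit (t % p ℕ.≟ 0))

  δ-cong : ∀ {a b} → a ≡ₚ b → δ a ≡ δ b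
  δ-cong (mk≡ₚ e) = cong (λ r → 𝟙 (r ℕ.≟ 0)) e

  periodic-δ : ∀ c → Periodic (λ s → δ (s ℕ.+ c))
  periodic-δ c t = δ-cong (begin
    t ℕ.+ p ℕ.+ c    ≡⟨ ℕ.+-assoc t p c ⟩
    t ℕ.+ (p ℕ.+ c)  ≡⟨ cong (t ℕ.+_) (ℕ.+-comm p c) ⟩
    t ℕ.+ (c ℕ.+ p)  ≡⟨ ℕ.+-assoc t c p ⟨
    t ℕ.+ c ℕ.+ p    ≈⟨ +p≡ₚ (t ℕ.+ c) ⟩
    t ℕ.+ c          ∎)
    where open ≡ₚ-Reasoning

  total-δ* : ∀ (F : ℕ → ℤ) → total (λ s → δ s * F s) ≡ F 0
  total-δ* F = trans (∑-point {p} (λ s → δ (toℕ s) * F (toℕ s)) Fin.zero vanish) (*-identityˡ (F 0))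
    where
    vanish : ∀ (j : Fin p) → j ≢ Fin.zero → δ (toℕ j) * F (toℕ j) ≡ 0ℤ
    vanish Fin.zero    j≢0 = contradiction refl j≢0
    vanish (Fin.suc j) _   = trans (cong (_* F (suc (toℕ j))) (𝟙-no (suc (toℕ j) % p ℕ.≟ 0) 1+j%p≢0))
                                   (*-zeroˡ (F (suc (toℕ j))))
      where
      1+j%p≢0 : suc (toℕ j) % p ≢ 0
      1+j%p≢0 e = ℕ.1+n≢0 (trans (sym (m<n⇒m%n≡m (Fin.toℕ<n (Fin.suc j)))) e)

  -- δ (s + c) picks out s ≡ -c ≡ c * k.
  total-δ-shift* : ∀ {h : ℕ → ℤ} → Periodic h → ∀ c → total (λ s → δ (s ℕ.+ c) * h s) ≡ h (c ℕ.* k)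
  total-δ-shift* {h} h-per c = begin
    total F
      ≡⟨ total-shift F-per (c ℕ.* k) ⟨
    total (λ s → F (s ℕ.+ c ℕ.* k))
      ≡⟨ total-cong (λ s → cong (_* h (s ℕ.+ c ℕ.* k)) (δ-cong (≡ₚ-trans (≡⇒≡ₚ (shift s)) (+*p≡ₚ s c)))) ⟩
    total (λ s → δ s * h (s ℕ.+ c ℕ.* k))
      ≡⟨ total-δ* (λ s → h (s ℕ.+ c ℕ.* k)) ⟩
    h (c ℕ.* k) ∎
    where
    open ≡-Reasoning
    F : ℕ → ℤ
    F s = δ (s ℕ.+ c) * h s
    F-per : Periodic F
    F-per t = cong₂ _*_ (periodic-δ c t) (h-per t)
    shift : ∀ s → s ℕ.+ c ℕ.* k ℕ.+ c ≡ s ℕ.+ c ℕ.* p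
    shift s = trans (ℕ.+-assoc s (c ℕ.* k) c) (cong (s ℕ.+_) (trans (ℕ.+-comm (c ℕ.* k) c) (sym (ℕ.*-suc c k))))

  total-δ-shift : ∀ c → total (λ s → δ (s ℕ.+ c)) ≡ 1ℤ
  total-δ-shift c = trans (total-cong (λ s → sym (*-identityʳ (δ (s ℕ.+ c)))))
                          (total-δ-shift* {λ _ → 1ℤ} (λ _ → refl) c)

  module _ (p-prime : Prime p) where

    *-cancelʳₚ-≤ : ∀ {w} → w % p ≢ 0 → ∀ {s t} → s ℕ.≤ t → t ℕ.< p →
                   s ℕ.* w ≡ₚ t ℕ.* w → s ≡ t
    *-cancelʳₚ-≤ {w} w≢0 {s} {t} s≤t t<p sw≡tw =
      trans (sym (ℕ.+-identityʳ s)) (trans (cong (s ℕ.+_) (sym d≡0)) s+d≡t)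
      where
      d = t ℕ.∸ s
      s+d≡t : s ℕ.+ d ≡ t
      s+d≡t = ℕ.m+[n∸m]≡n s≤t
      dw≡0 : d ℕ.* w ≡ₚ 0
      dw≡0 = +-cancelʳₚ (d ℕ.* w) 0 (s ℕ.* w) (begin
        d ℕ.* w ℕ.+ s ℕ.* w    ≡⟨ ℕ.*-distribʳ-+ w d s ⟨
        (d ℕ.+ s) ℕ.* w        ≡⟨ cong (ℕ._* w) (trans (ℕ.+-comm d s) s+d≡t) ⟩
        t ℕ.* w                ≈⟨ sw≡tw ⟨
        s ℕ.* w                ∎)
        where open ≡ₚ-Reasoning
      d≡0 : d ≡ 0
      d≡0 with euclidsLemma d w p-prime (ℕ.m%n≡0⇒n∣m (d ℕ.* w) p (%≡% dw≡0))
      ... | inj₁ p∣d = m∣n∧n<m⇒n≡0 p∣d (ℕ.≤-<-trans (ℕ.m∸n≤m t s) t<p)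
      ... | inj₂ p∣w = contradiction (ℕ.n∣m⇒m%n≡0 w p p∣w) w≢0

    *-cancelʳₚ : ∀ {w} → w % p ≢ 0 → ∀ {s t} → s ℕ.< p → t ℕ.< p →
                 s ℕ.* w ≡ₚ t ℕ.* w → s ≡ t
    *-cancelʳₚ w≢0 {s} {t} s<p t<p sw≡tw with ℕ.≤-total s t
    ... | inj₁ s≤t = *-cancelʳₚ-≤ w≢0 s≤t t<p sw≡tw
    ... | inj₂ t≤s = sym (*-cancelʳₚ-≤ w≢0 t≤s s<p (≡ₚ-sym sw≡tw))

    linear-root : ∀ {w} → w % p ≢ 0 → ∀ c → Σ[ s ∈ ℕ ] c ℕ.+ s ℕ.* w ≡ₚ 0
    linear-root {w} w≢0 c with coprime-Bézout (prime⇒coprime p-prime {{ℕ.≢-nonZero w≢0}} (m%n<n w p))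
    ... | Bézout.+- x y 1+yn≡xp = c ℕ.* y , (begin
      c ℕ.+ c ℕ.* y ℕ.* w            ≈⟨ +-congₚ (≡ₚ-refl {c}) (*-congₚ (≡ₚ-refl {c ℕ.* y}) (%≡ₚ w)) ⟨
      c ℕ.+ c ℕ.* y ℕ.* n            ≡⟨ factor c y n ⟩
      c ℕ.* (1 ℕ.+ y ℕ.* n)          ≡⟨ cong (c ℕ.*_) 1+yn≡xp ⟩
      c ℕ.* (x ℕ.* p)                ≡⟨ reassoc c x p ⟩
      0 ℕ.+ c ℕ.* x ℕ.* p            ≈⟨ +*p≡ₚ 0 (c ℕ.* x) ⟩
      0                              ∎)
      where
      open ≡ₚ-Reasoning
      n = w % p
      factor : ∀ c y n → c ℕ.+ c ℕ.* y ℕ.* n ≡ c ℕ.* (1 ℕ.+ y ℕ.* n)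
      factor = ℕSolver.solve-∀
      reassoc : ∀ c x p → c ℕ.* (x ℕ.* p) ≡ 0 ℕ.+ c ℕ.* x ℕ.* p
      reassoc = ℕSolver.solve-∀
    ... | Bézout.-+ x y 1+xp≡yn = c ℕ.* k ℕ.* y , (begin
      c ℕ.+ c ℕ.* k ℕ.* y ℕ.* w
        ≈⟨ +-congₚ (≡ₚ-refl {c}) (*-congₚ (≡ₚ-refl {c ℕ.* k ℕ.* y}) (%≡ₚ w)) ⟨
      c ℕ.+ c ℕ.* k ℕ.* y ℕ.* n
        ≡⟨ factor c k y n ⟩
      c ℕ.+ c ℕ.* k ℕ.* (y ℕ.* n)
        ≡⟨ cong (λ z → c ℕ.+ c ℕ.* k ℕ.* z) 1+xp≡yn ⟨
      c ℕ.+ c ℕ.* k ℕ.* (1 ℕ.+ x ℕ.* p)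
        ≡⟨ expand c k x ⟩
      0 ℕ.+ (c ℕ.+ c ℕ.* k ℕ.* x) ℕ.* p
        ≈⟨ +*p≡ₚ 0 (c ℕ.+ c ℕ.* k ℕ.* x) ⟩
      0 ∎)
      where
      open ≡ₚ-Reasoning
      n = w % p
      factor : ∀ c k y n → c ℕ.+ c ℕ.* k ℕ.* y ℕ.* n ≡ c ℕ.+ c ℕ.* k ℕ.* (y ℕ.* n)
      factor = ℕSolver.solve-∀
      expand : ∀ c k x → c ℕ.+ c ℕ.* k ℕ.* (1 ℕ.+ x ℕ.* suc k) ≡ 0 ℕ.+ (c ℕ.+ c ℕ.* k ℕ.* x) ℕ.* suc k
      expand = ℕSolver.solve-∀

    ∑-δ-linear : ∀ {w} → w % p ≢ 0 → ∀ c → ∑[ κ < p ] δ (c ℕ.+ toℕ κ ℕ.* w) ≡ 1ℤ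
    ∑-δ-linear {w} w≢0 c =
      trans (∑-point {p} (λ κ → δ (c ℕ.+ toℕ κ ℕ.* w)) κ₀ vanish) (𝟙-yes (_ ℕ.≟ 0) (%≡% root₀))
      where
      s = proj₁ (linear-root {w} w≢0 c)
      κ₀ = s mod p
      root₀ : c ℕ.+ toℕ κ₀ ℕ.* w ≡ₚ 0
      root₀ = ≡ₚ-trans (+-congₚ (≡ₚ-refl {c}) (*-congₚ (toℕ-mod s) (≡ₚ-refl {w})))
                       (proj₂ (linear-root {w} w≢0 c))
      vanish : ∀ κ → κ ≢ κ₀ → δ (c ℕ.+ toℕ κ ℕ.* w) ≡ 0ℤ
      vanish κ κ≢κ₀ = 𝟙-no (_ ℕ.≟ 0) λ root → κ≢κ₀ (Fin.toℕ-injective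
        (*-cancelʳₚ w≢0 (Fin.toℕ<n κ) (Fin.toℕ<n κ₀) (+-cancelʳₚ _ _ c (begin
          toℕ κ ℕ.* w ℕ.+ c     ≡⟨ ℕ.+-comm _ c ⟩
          c ℕ.+ toℕ κ ℕ.* w     ≈⟨ mk≡ₚ root ⟩
          0                     ≈⟨ root₀ ⟨
          c ℕ.+ toℕ κ₀ ℕ.* w    ≡⟨ ℕ.+-comm c _ ⟩
          toℕ κ₀ ℕ.* w ℕ.+ c    ∎))))
        where open ≡ₚ-Reasoning

module Lattice (k : ℕ) where

  open import Data.Integer using (_+_; _*_; -_; _-_)
  open Sums
  open Periodic k
  open Residues k

  ∑ᵥ : ∀ d → (Vertex k d → ℤ) → ℤ
  ∑ᵥ zero    f = f []
  ∑ᵥ (suc d) f = ∑[ a < p ] ∑ᵥ d (λ z → f (a ∷ z))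

  ∑ᵥ-cong : ∀ d {f g : Vertex k d → ℤ} → (∀ z → f z ≡ g z) → ∑ᵥ d f ≡ ∑ᵥ d g
  ∑ᵥ-cong zero    f≗g = f≗g []
  ∑ᵥ-cong (suc d) f≗g = sum-cong-≗ {p} (λ a → ∑ᵥ-cong d (λ z → f≗g (a ∷ z)))

  ∑ᵥ-comm-∑ : ∀ d {n} (f : Vertex k d → Fin n → ℤ) →
              ∑ᵥ d (λ z → ∑[ j < n ] f z j) ≡ ∑[ j < n ] ∑ᵥ d (λ z → f z j)
  ∑ᵥ-comm-∑ zero    f = refl
  ∑ᵥ-comm-∑ (suc d) {n} f = trans (sum-cong-≗ {p} (λ a → ∑ᵥ-comm-∑ d (λ z → f (a ∷ z))))
                                  (∑-comm {p} {n} (λ a j → ∑ᵥ d (λ z → f (a ∷ z) j)))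

  ∑ᵥ-+ : ∀ d (f g : Vertex k d → ℤ) → ∑ᵥ d (λ z → f z + g z) ≡ ∑ᵥ d f + ∑ᵥ d g
  ∑ᵥ-+ zero    f g = refl
  ∑ᵥ-+ (suc d) f g = trans (sum-cong-≗ {p} (λ a → ∑ᵥ-+ d (λ z → f (a ∷ z)) (λ z → g (a ∷ z))))
                           (∑-distrib-+ {p} (λ a → ∑ᵥ d (λ z → f (a ∷ z))) (λ a → ∑ᵥ d (λ z → g (a ∷ z))))

  ∑ᵥ-*ˡ : ∀ d c (f : Vertex k d → ℤ) → ∑ᵥ d (λ z → c * f z) ≡ c * ∑ᵥ d f
  ∑ᵥ-*ˡ zero    c f = refl
  ∑ᵥ-*ˡ (suc d) c f = trans (sum-cong-≗ {p} (λ a → ∑ᵥ-*ˡ d c (λ z → f (a ∷ z))))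
                            (sym (*-distribˡ-sum {p} c (λ a → ∑ᵥ d (λ z → f (a ∷ z)))))

  ∑ᵥ-zero : ∀ d {f : Vertex k d → ℤ} → (∀ z → f z ≡ 0ℤ) → ∑ᵥ d f ≡ 0ℤ
  ∑ᵥ-zero zero    f≗0 = f≗0 []
  ∑ᵥ-zero (suc d) f≗0 = ∑-zero {p} (λ a → ∑ᵥ-zero d (λ z → f≗0 (a ∷ z)))

  ∑ᵥ-const : ∀ d c → ∑ᵥ d (λ _ → c) ≡ + (p ℕ.^ d) * c
  ∑ᵥ-const zero    c = sym (*-identityˡ c)
  ∑ᵥ-const (suc d) c = begin
    ∑[ a < p ] ∑ᵥ d (λ _ → c)       ≡⟨ sum-cong-≗ {p} (λ _ → ∑ᵥ-const d c) ⟩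
    ∑[ a < p ] (+ (p ℕ.^ d) * c)     ≡⟨ ∑-const p _ ⟩
    + p * (+ (p ℕ.^ d) * c)          ≡⟨ *-assoc (+ p) (+ (p ℕ.^ d)) c ⟨
    + p * + (p ℕ.^ d) * c            ≡⟨ cong (_* c) (pos-* p (p ℕ.^ d)) ⟨
    + (p ℕ.^ suc d) * c              ∎
    where open ≡-Reasoning

  ∑ᵥ-comm : ∀ d e (f : Vertex k d → Vertex k e → ℤ) →
            ∑ᵥ d (λ z → ∑ᵥ e (λ w → f z w)) ≡ ∑ᵥ e (λ w → ∑ᵥ d (λ z → f z w))
  ∑ᵥ-comm zero    e f = refl
  ∑ᵥ-comm (suc d) e f = trans (sum-cong-≗ {p} (λ a → ∑ᵥ-comm d e (λ z → f (a ∷ z))))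
                              (sym (∑ᵥ-comm-∑ e (λ w a → ∑ᵥ d (λ z → f (a ∷ z) w))))

  ∑ᵥ-translate : ∀ d j (σ : Fin p → Fin p) c → (∀ a → toℕ (σ a) ≡ₚ toℕ a ℕ.+ c) →
                 ∀ f → ∑ᵥ d (λ z → f (updateAt z j σ)) ≡ ∑ᵥ d f
  ∑ᵥ-translate (suc d) Fin.zero    σ c σ≡ f = ∑-translate σ c σ≡ (λ b → ∑ᵥ d (λ z → f (b ∷ z)))
  ∑ᵥ-translate (suc d) (Fin.suc j) σ c σ≡ f =
    sum-cong-≗ {p} (λ a → ∑ᵥ-translate d j σ c σ≡ (λ z → f (a ∷ z)))

  infix 4 _≟ᵥ_

  _≟ᵥ_ : ∀ {d} (u v : Vertex k d) → Dec (u ≡ v)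
  _≟ᵥ_ = Vec.≡-dec Fin._≟_

  𝟙-∷ : ∀ {d} a b (z x : Vertex k d) → 𝟙 (a ∷ z ≟ᵥ b ∷ x) ≡ 𝟙 (a Fin.≟ b) * 𝟙 (z ≟ᵥ x)
  𝟙-∷ a b z x = split (a Fin.≟ b) (z ≟ᵥ x)
    where
    split : (a≟b : Dec (a ≡ b)) (z≟x : Dec (z ≡ x)) → 𝟙 (a ∷ z ≟ᵥ b ∷ x) ≡ 𝟙 a≟b * 𝟙 z≟x
    split (yes a≡b) (yes z≡x) = 𝟙-yes (a ∷ z ≟ᵥ b ∷ x) (cong₂ _∷_ a≡b z≡x)
    split (yes _)   (no z≢x)  = 𝟙-no (a ∷ z ≟ᵥ b ∷ x) (z≢x ∘ proj₂ ∘ Vec.∷-injective)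
    split (no a≢b)  z≟x       = trans (𝟙-no (a ∷ z ≟ᵥ b ∷ x) (a≢b ∘ proj₁ ∘ Vec.∷-injective))
                                      (sym (*-zeroˡ (𝟙 z≟x)))

  𝟙-∷-same : ∀ {d} a (z x : Vertex k d) → 𝟙 (a ∷ z ≟ᵥ a ∷ x) ≡ 𝟙 (z ≟ᵥ x)
  𝟙-∷-same a z x =
    trans (𝟙-∷ a a z x) (trans (cong (_* 𝟙 (z ≟ᵥ x)) (𝟙-yes (a Fin.≟ a) refl)) (*-identityˡ (𝟙 (z ≟ᵥ x))))

  ∑-point-𝟙 : ∀ b (G : Fin p → ℤ) → ∑[ a < p ] (𝟙 (a Fin.≟ b) * G a) ≡ G b
  ∑-point-𝟙 b G = trans (∑-point {p} (λ a → 𝟙 (a Fin.≟ b) * G a) b vanish)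
                        (trans (cong (_* G b) (𝟙-yes (b Fin.≟ b) refl)) (*-identityˡ (G b)))
    where
    vanish : ∀ a → a ≢ b → 𝟙 (a Fin.≟ b) * G a ≡ 0ℤ
    vanish a a≢b = trans (cong (_* G a) (𝟙-no (a Fin.≟ b) a≢b)) (*-zeroˡ (G a))

  ∑ᵥ-point : ∀ d (x : Vertex k d) (G : Vertex k d → ℤ) → ∑ᵥ d (λ z → 𝟙 (z ≟ᵥ x) * G z) ≡ G x
  ∑ᵥ-point zero    []      G = *-identityˡ (G [])
  ∑ᵥ-point (suc d) (b ∷ x) G = begin
    ∑[ a < p ] ∑ᵥ d (λ z → 𝟙 (a ∷ z ≟ᵥ b ∷ x) * G (a ∷ z))
      ≡⟨ sum-cong-≗ {p} (λ a → ∑ᵥ-cong d (λ z → trans (cong (_* G (a ∷ z)) (𝟙-∷ a b z x))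
                                                    (*-assoc (𝟙 (a Fin.≟ b)) (𝟙 (z ≟ᵥ x)) (G (a ∷ z))))) ⟩
    ∑[ a < p ] ∑ᵥ d (λ z → 𝟙 (a Fin.≟ b) * (𝟙 (z ≟ᵥ x) * G (a ∷ z)))
      ≡⟨ sum-cong-≗ {p} (λ a → trans (∑ᵥ-*ˡ d (𝟙 (a Fin.≟ b)) (λ z → 𝟙 (z ≟ᵥ x) * G (a ∷ z)))
                                       (cong (𝟙 (a Fin.≟ b) *_) (∑ᵥ-point d x (λ z → G (a ∷ z))))) ⟩
    ∑[ a < p ] (𝟙 (a Fin.≟ b) * G (a ∷ x))
      ≡⟨ ∑-point-𝟙 b (λ a → G (a ∷ x)) ⟩
    G (b ∷ x) ∎
    where open ≡-Reasoning

  zeroAt : ∀ {d} → Fin d → Vertex k d → Vertex k d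
  zeroAt i z = updateAt z i (λ _ → Fin.zero)

  ∑ᵥ-line : ∀ d i (x : Vertex k d) (G : Vertex k d → ℤ) →
            ∑ᵥ d (λ z → 𝟙 (zeroAt i z ≟ᵥ zeroAt i x) * G z) ≡ ∑[ t < p ] G (updateAt x i (λ _ → t))
  ∑ᵥ-line (suc d) Fin.zero    (b ∷ x) G = sum-cong-≗ {p} λ a → begin
    ∑ᵥ d (λ z → 𝟙 (Fin.zero ∷ z ≟ᵥ Fin.zero ∷ x) * G (a ∷ z))
      ≡⟨ ∑ᵥ-cong d (λ z → cong (_* G (a ∷ z)) (𝟙-∷-same Fin.zero z x)) ⟩
    ∑ᵥ d (λ z → 𝟙 (z ≟ᵥ x) * G (a ∷ z))
      ≡⟨ ∑ᵥ-point d x (λ z → G (a ∷ z)) ⟩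
    G (a ∷ x) ∎
    where open ≡-Reasoning
  ∑ᵥ-line (suc d) (Fin.suc i) (b ∷ x) G = begin
    ∑[ a < p ] ∑ᵥ d (λ z → 𝟙 (a ∷ zeroAt i z ≟ᵥ b ∷ zeroAt i x) * G (a ∷ z))
      ≡⟨ sum-cong-≗ {p} (λ a → ∑ᵥ-cong d (λ z → trans (cong (_* G (a ∷ z)) (𝟙-∷ a b (zeroAt i z) (zeroAt i x)))
                              (*-assoc (𝟙 (a Fin.≟ b)) (𝟙 (zeroAt i z ≟ᵥ zeroAt i x)) (G (a ∷ z))))) ⟩
    ∑[ a < p ] ∑ᵥ d (λ z → 𝟙 (a Fin.≟ b) * (𝟙 (zeroAt i z ≟ᵥ zeroAt i x) * G (a ∷ z)))
      ≡⟨ sum-cong-≗ {p} (λ a → ∑ᵥ-*ˡ d (𝟙 (a Fin.≟ b)) (λ z → 𝟙 (zeroAt i z ≟ᵥ zeroAt i x) * G (a ∷ z))) ⟩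
    ∑[ a < p ] (𝟙 (a Fin.≟ b) * ∑ᵥ d (λ z → 𝟙 (zeroAt i z ≟ᵥ zeroAt i x) * G (a ∷ z)))
      ≡⟨ ∑-point-𝟙 b (λ a → ∑ᵥ d (λ z → 𝟙 (zeroAt i z ≟ᵥ zeroAt i x) * G (a ∷ z))) ⟩
    ∑ᵥ d (λ z → 𝟙 (zeroAt i z ≟ᵥ zeroAt i x) * G (b ∷ z))
      ≡⟨ ∑ᵥ-line d i x (λ z → G (b ∷ z)) ⟩
    ∑[ t < p ] G (b ∷ updateAt x i (λ _ → t)) ∎
    where open ≡-Reasoning

  dot : ∀ {d} → Vertex k d → Vertex k d → ℕ
  dot []      []      = 0
  dot (a ∷ κ) (b ∷ z) = toℕ a ℕ.* toℕ b ℕ.+ dot κ z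

  dot-updateAt : ∀ {d} (κ z : Vertex k d) j {σ : Fin p → Fin p} {c} → (∀ a → toℕ (σ a) ≡ₚ toℕ a ℕ.+ c) →
                 dot κ (updateAt z j σ) ≡ₚ dot κ z ℕ.+ toℕ (lookup κ j) ℕ.* c
  dot-updateAt (a ∷ κ) (b ∷ z) Fin.zero {σ} {c} σ≡ = begin
    toℕ a ℕ.* toℕ (σ b) ℕ.+ dot κ z
      ≈⟨ +-congₚ (*-congₚ (≡ₚ-refl {toℕ a}) (σ≡ b)) (≡ₚ-refl {dot κ z}) ⟩
    toℕ a ℕ.* (toℕ b ℕ.+ c) ℕ.+ dot κ z
      ≡⟨ distrib (toℕ a) (toℕ b) c (dot κ z) ⟩
    toℕ a ℕ.* toℕ b ℕ.+ dot κ z ℕ.+ toℕ a ℕ.* c ∎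
    where
    open ≡ₚ-Reasoning
    distrib : ∀ a b c d → a ℕ.* (b ℕ.+ c) ℕ.+ d ≡ a ℕ.* b ℕ.+ d ℕ.+ a ℕ.* c
    distrib = ℕSolver.solve-∀
  dot-updateAt (a ∷ κ) (b ∷ z) (Fin.suc j) σ≡ = ≡ₚ-trans
    (+-congₚ (≡ₚ-refl {toℕ a ℕ.* toℕ b}) (dot-updateAt κ z j σ≡))
    (≡⇒≡ₚ (sym (ℕ.+-assoc (toℕ a ℕ.* toℕ b) (dot κ z) _)))

  dot-zeroAt : ∀ {d} (κ z : Vertex k d) i → dot (zeroAt i κ) z ≡ dot κ (zeroAt i z)
  dot-zeroAt (a ∷ κ) (b ∷ z) Fin.zero    = cong (ℕ._+ dot κ z) (sym (ℕ.*-zeroʳ (toℕ a)))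
  dot-zeroAt (a ∷ κ) (b ∷ z) (Fin.suc i) = cong (toℕ a ℕ.* toℕ b ℕ.+_) (dot-zeroAt κ z i)

  -- The number of κ with c + κ·u − κ·v ≡ 0, written with k ≡ −1 to stay in ℕ.
  solutions : ∀ d → ℕ → Vertex k d → Vertex k d → ℤ
  solutions d c u v = ∑ᵥ d (λ κ → δ (c ℕ.+ dot κ u ℕ.+ dot κ v ℕ.* k))

  solutions-≡ : ∀ d c u → solutions d c u u ≡ + (p ℕ.^ d) * δ c
  solutions-≡ d c u =
    trans (∑ᵥ-cong d (λ κ → δ-cong (≡ₚ-trans (≡⇒≡ₚ (regroup c (dot κ u) k)) (+*p≡ₚ c (dot κ u)))))
                            (∑ᵥ-const d (δ c))
    where
    regroup : ∀ c x k → c ℕ.+ x ℕ.+ x ℕ.* k ≡ c ℕ.+ x ℕ.* (1 ℕ.+ k)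
    regroup = ℕSolver.solve-∀

  ≢⇒difference≢0 : ∀ {a b : Fin p} → a ≢ b → (toℕ a ℕ.+ toℕ b ℕ.* k) % p ≢ 0
  ≢⇒difference≢0 {a} {b} a≢b diff≡0 = a≢b (toℕ-injectiveₚ (begin
    toℕ a                                ≈⟨ +*p≡ₚ (toℕ a) (toℕ b) ⟨
    toℕ a ℕ.+ toℕ b ℕ.* p                ≡⟨ regroup (toℕ a) (toℕ b) k ⟩
    toℕ a ℕ.+ toℕ b ℕ.* k ℕ.+ toℕ b      ≈⟨ +-congₚ (mk≡ₚ diff≡0) (≡ₚ-refl {toℕ b}) ⟩
    0 ℕ.+ toℕ b                          ≡⟨⟩
    toℕ b                                ∎))
    where
    open ≡ₚ-Reasoning
    regroup : ∀ a b k → a ℕ.+ b ℕ.* suc k ≡ a ℕ.+ b ℕ.* k ℕ.+ b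
    regroup = ℕSolver.solve-∀

  ν : ∀ {d} → Vertex k d → ℕ → ℤ
  ν {d} κ s = δ s + ∑[ j < d ] (δ (s ℕ.+ toℕ (lookup κ j)) + δ (s ℕ.+ toℕ (lookup κ j) ℕ.* k))

  periodic-ν : ∀ {d} (κ : Vertex k d) → Periodic (ν κ)
  periodic-ν {d} κ t = cong₂ _+_ (δ-cong (+p≡ₚ t)) (sum-cong-≗ {d} λ j →
    cong₂ _+_ (periodic-δ (toℕ (lookup κ j)) t) (periodic-δ (toℕ (lookup κ j) ℕ.* k) t))

  total-ν : ∀ {d} (κ : Vertex k d) → total (ν κ) ≡ + (1 ℕ.+ 2 ℕ.* d)
  total-ν {d} κ = begin
    total (λ s → δ s + ∑[ j < d ] (δ (s ℕ.+ c j) + δ (s ℕ.+ c j ℕ.* k)))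
      ≡⟨ total-+ δ (λ s → ∑[ j < d ] (δ (s ℕ.+ c j) + δ (s ℕ.+ c j ℕ.* k))) ⟩
    total δ + total (λ s → ∑[ j < d ] (δ (s ℕ.+ c j) + δ (s ℕ.+ c j ℕ.* k)))
      ≡⟨ cong (_+_ (total δ)) (∑-comm {p} {d} (λ s j → δ (toℕ s ℕ.+ c j) + δ (toℕ s ℕ.+ c j ℕ.* k))) ⟩
    total δ + ∑[ j < d ] total (λ s → δ (s ℕ.+ c j) + δ (s ℕ.+ c j ℕ.* k))
      ≡⟨ cong₂ _+_ (trans (total-cong (λ s → cong δ (sym (ℕ.+-identityʳ s)))) (total-δ-shift 0))
                   (sum-cong-≗ {d} λ j → trans (total-+ (λ s → δ (s ℕ.+ c j)) (λ s → δ (s ℕ.+ c j ℕ.* k)))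
                                               (cong₂ _+_ (total-δ-shift (c j)) (total-δ-shift (c j ℕ.* k)))) ⟩
    1ℤ + ∑[ j < d ] (1ℤ + 1ℤ)
      ≡⟨ cong (_+_ 1ℤ) (∑-const d (+ 2)) ⟩
    1ℤ + + d * + 2
      ≡⟨ cong (_+_ 1ℤ) (trans (*-comm (+ d) (+ 2)) (sym (pos-* 2 d))) ⟩
    + (1 ℕ.+ 2 ℕ.* d) ∎
    where
    open ≡-Reasoning
    c : Fin d → ℕ
    c j = toℕ (lookup κ j)

  3≤ν[0] : ∀ {d} {κ : Vertex k d} i → lookup κ i ≡ Fin.zero → + 3 ≤ ν κ 0
  3≤ν[0] {d} {κ} i κᵢ≡0 = +-monoʳ-≤ 1ℤ (subst (_≤ sum term) (cong (λ a → δ (toℕ a) + δ (toℕ a ℕ.* k)) κᵢ≡0)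
    (∑-≥-term {f = term} (λ j → +-mono-≤ (δ-nonneg (toℕ (lookup κ j))) (δ-nonneg (toℕ (lookup κ j) ℕ.* k)))
              i))
    where
    term : Fin d → ℤ
    term j = δ (toℕ (lookup κ j)) + δ (toℕ (lookup κ j) ℕ.* k)

  nbhdSum : ∀ {d} → (Vertex k d → ℤ) → Vertex k d → ℤ
  nbhdSum {d} f z = f z + ∑[ j < d ] (f (updateAt z j sucMod) + f (updateAt z j predMod))

  nbhdSum-affine : ∀ {d} a c (f : Vertex k d → ℤ) v →
                   nbhdSum (λ u → a * f u + c) v ≡ a * nbhdSum f v + + (1 ℕ.+ 2 ℕ.* d) * c
  nbhdSum-affine {d} a c f v = begin
    a * f v + c + ∑[ j < d ] (a * f⁺ j + c + (a * f⁻ j + c))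
      ≡⟨ cong (_+_ (a * f v + c)) (sum-cong-≗ {d} (λ j → pair a c (f⁺ j) (f⁻ j))) ⟩
    a * f v + c + ∑[ j < d ] (a * (f⁺ j + f⁻ j) + + 2 * c)
      ≡⟨ cong (_+_ (a * f v + c)) (∑-distrib-+ {d} (λ j → a * (f⁺ j + f⁻ j)) (λ _ → + 2 * c)) ⟩
    a * f v + c + (∑[ j < d ] (a * (f⁺ j + f⁻ j)) + ∑[ j < d ] (+ 2 * c))
      ≡⟨ cong₂ (λ x y → a * f v + c + (x + y)) (sym (*-distribˡ-sum {d} a (λ j → f⁺ j + f⁻ j))) (∑-const d (+ 2 * c)) ⟩
    a * f v + c + (a * ∑[ j < d ] (f⁺ j + f⁻ j) + + d * (+ 2 * c))
      ≡⟨ collect a c (f v) (∑[ j < d ] (f⁺ j + f⁻ j)) (+ d) ⟩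
    a * nbhdSum f v + (1ℤ + + 2 * + d) * c
      ≡⟨ cong (λ m → a * nbhdSum f v + (1ℤ + m) * c) (pos-* 2 d) ⟨
    a * nbhdSum f v + + (1 ℕ.+ 2 ℕ.* d) * c
      ∎
    where
    open ≡-Reasoning
    f⁺ f⁻ : Fin d → ℤ
    f⁺ j = f (updateAt v j sucMod)
    f⁻ j = f (updateAt v j predMod)
    pair : ∀ a c x y → a * x + c + (a * y + c) ≡ a * (x + y) + + 2 * c
    pair = solve-∀
    collect : ∀ a c x s m → a * x + c + (a * s + m * (+ 2 * c)) ≡ a * (x + s) + (1ℤ + + 2 * m) * c
    collect = solve-∀

  sucMod-dominates : ∀ {d} (v : Vertex k d) j → Dominates (updateAt v j sucMod) v
  sucMod-dominates v j = inj₂ (j , inj₂ (Vec.lookup∘updateAt j v) , λ i i≢j → Vec.lookup∘updateAt′ i j i≢j v)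

  predMod-dominates : ∀ {d} (v : Vertex k d) j → Dominates (updateAt v j predMod) v
  predMod-dominates v j = inj₂
    ( j
    , inj₁ (trans (sym (sucMod∘predMod (lookup v j))) (cong sucMod (sym (Vec.lookup∘updateAt j v))))
    , λ i i≢j → Vec.lookup∘updateAt′ i j i≢j v)

  InNbhd : ∀ {d} → Vertex k d → Vertex k d → Set
  InNbhd {d} s v = s ≡ v ⊎ Σ[ i ∈ Fin d ] (s ≡ updateAt v i sucMod ⊎ s ≡ updateAt v i predMod)

  dominates⇒InNbhd : ∀ {d} {s v : Vertex k d} → Dominates s v → InNbhd s v
  dominates⇒InNbhd (inj₁ s≡v) = inj₁ s≡v
  dominates⇒InNbhd (inj₂ (i , inj₂ sᵢ≡1+vᵢ , s≗v)) = inj₂ (i , inj₁ (≡updateAt i sᵢ≡1+vᵢ s≗v))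
  dominates⇒InNbhd {s = s} (inj₂ (i , inj₁ vᵢ≡1+sᵢ , s≗v)) =
    inj₂ (i , inj₂ (≡updateAt i (trans (sym (predMod∘sucMod (lookup s i))) (cong predMod (sym vᵢ≡1+sᵢ))) s≗v))

  module _ (2≤k : 2 ℕ.≤ k) where

    private
      0<k : 0 ℕ.< k
      0<k = ℕ.<-trans ℕ.z<s 2≤k

    𝟙-off-axis : ∀ {d} (v : Vertex k d) {i j} (τ : Fin p → Fin p) → j ≢ i →
                 𝟙 (updateAt v j sucMod ≟ᵥ updateAt v i τ) + 𝟙 (updateAt v j predMod ≟ᵥ updateAt v i τ) ≡ 0ℤ
    𝟙-off-axis v τ j≢i = cong₂ _+_ (𝟙-no (_ ≟ᵥ _) (updateAt-≢-other v j≢i (sucMod≢id 0<k)))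
                                   (𝟙-no (_ ≟ᵥ _) (updateAt-≢-other v j≢i (predMod≢id 0<k)))

    nbhdSum-𝟙 : ∀ {d} (v : Vertex k d) {s} → InNbhd s v → nbhdSum (λ u → 𝟙 (u ≟ᵥ s)) v ≡ 1ℤ
    nbhdSum-𝟙 {d} v (inj₁ refl) = cong₂ _+_ (𝟙-yes (v ≟ᵥ v) refl) (∑-zero {d} λ j → cong₂ _+_
      (𝟙-no (_ ≟ᵥ v) (updateAt-≢ v j (sucMod≢id 0<k))) (𝟙-no (_ ≟ᵥ v) (updateAt-≢ v j (predMod≢id 0<k))))
    nbhdSum-𝟙 {d} v (inj₂ (i , inj₁ refl)) = cong₂ _+_
      (𝟙-no (v ≟ᵥ _) (updateAt-≢ v i (sucMod≢id 0<k) ∘ sym))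
      (trans (∑-point {d} (λ j → 𝟙 (updateAt v j sucMod ≟ᵥ updateAt v i sucMod) + 𝟙 (updateAt v j predMod ≟ᵥ updateAt v i sucMod))
                            i (λ j → 𝟙-off-axis v sucMod))
             (cong₂ _+_ (𝟙-yes (updateAt v i sucMod ≟ᵥ _) refl) (𝟙-no (_ ≟ᵥ _) (updateAt-≢-same v i (sucMod≢predMod 2≤k) ∘ sym))))
    nbhdSum-𝟙 {d} v (inj₂ (i , inj₂ refl)) = cong₂ _+_
      (𝟙-no (v ≟ᵥ _) (updateAt-≢ v i (predMod≢id 0<k) ∘ sym))
      (trans (∑-point {d} (λ j → 𝟙 (updateAt v j sucMod ≟ᵥ updateAt v i predMod) + 𝟙 (updateAt v j predMod ≟ᵥ updateAt v i predMod))
                            i (λ j → 𝟙-off-axis v predMod))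
             (cong₂ _+_ (𝟙-no (_ ≟ᵥ _) (updateAt-≢-same v i (sucMod≢predMod 2≤k))) (𝟙-yes (updateAt v i predMod ≟ᵥ _) refl)))

  ∑ᵥ-nbhdSum : ∀ d (f : Vertex k d → ℤ) → ∑ᵥ d (nbhdSum f) ≡ + (1 ℕ.+ 2 ℕ.* d) * ∑ᵥ d f
  ∑ᵥ-nbhdSum d f = begin
    ∑ᵥ d (λ z → f z + ∑[ j < d ] (f⁺ j z + f⁻ j z))
      ≡⟨ ∑ᵥ-+ d f (λ z → ∑[ j < d ] (f⁺ j z + f⁻ j z)) ⟩
    F + ∑ᵥ d (λ z → ∑[ j < d ] (f⁺ j z + f⁻ j z))
      ≡⟨ cong (_+_ F) (∑ᵥ-comm-∑ d (λ z j → f⁺ j z + f⁻ j z)) ⟩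
    F + ∑[ j < d ] ∑ᵥ d (λ z → f⁺ j z + f⁻ j z)
      ≡⟨ cong (_+_ F) (sum-cong-≗ {d} translate) ⟩
    F + ∑[ j < d ] (F + F)
      ≡⟨ cong (_+_ F) (∑-const d (F + F)) ⟩
    F + + d * (F + F)
      ≡⟨ collect F (+ d) ⟩
    (1ℤ + + 2 * + d) * F
      ≡⟨ cong (λ m → (1ℤ + m) * F) (pos-* 2 d) ⟨
    + (1 ℕ.+ 2 ℕ.* d) * F ∎
    where
    open ≡-Reasoning
    F = ∑ᵥ d f
    f⁺ f⁻ : Fin d → Vertex k d → ℤ
    f⁺ j z = f (updateAt z j sucMod)
    f⁻ j z = f (updateAt z j predMod)
    translate : ∀ j → ∑ᵥ d (λ z → f⁺ j z + f⁻ j z) ≡ F + F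
    translate j = trans (∑ᵥ-+ d (f⁺ j) (f⁻ j))
                        (cong₂ _+_ (∑ᵥ-translate d j sucMod 1 sucMod≡ₚ f) (∑ᵥ-translate d j predMod k predMod≡ₚ f))
    collect : ∀ F m → F + m * (F + F) ≡ (1ℤ + + 2 * m) * F
    collect = solve-∀

  module _ (p-prime : Prime p) where

    solutions-≢ : ∀ d c (u v : Vertex k d) → u ≢ v → + p * solutions d c u v ≡ + (p ℕ.^ d)
    solutions-≢ zero    c []      []      []≢[] = contradiction refl []≢[]
    solutions-≢ (suc d) c (a ∷ u) (b ∷ v) a∷u≢b∷v = begin
      + p * solutions (suc d) c (a ∷ u) (b ∷ v)    ≡⟨ cong (+ p *_) (sum-cong-≗ {p} (λ κ₁ → ∑ᵥ-cong d (λ κ → cong δ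
                                                        (regroup c (toℕ κ₁ ℕ.* toℕ a) (dot κ u) (toℕ κ₁ ℕ.* toℕ b) (dot κ v) k)))) ⟩
      + p * ∑[ κ₁ < p ] solutions d (c′ κ₁) u v
        ≡⟨ *-distribˡ-sum {p} (+ p) (λ κ₁ → solutions d (c′ κ₁) u v) ⟩
      ∑[ κ₁ < p ] (+ p * solutions d (c′ κ₁) u v)
        ≡⟨ by-tails (u ≟ᵥ v) ⟩
      + p * + (p ℕ.^ d)
        ≡⟨ pos-* p (p ℕ.^ d) ⟨
      + (p ℕ.^ suc d) ∎
      where
      open ≡-Reasoning
      c′ : Fin p → ℕ
      c′ κ₁ = c ℕ.+ toℕ κ₁ ℕ.* toℕ a ℕ.+ toℕ κ₁ ℕ.* toℕ b ℕ.* k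
      regroup : ∀ c x y w z k → c ℕ.+ (x ℕ.+ y) ℕ.+ (w ℕ.+ z) ℕ.* k ≡ c ℕ.+ x ℕ.+ w ℕ.* k ℕ.+ y ℕ.+ z ℕ.* k
      regroup = ℕSolver.solve-∀
      by-tails : Dec (u ≡ v) → ∑[ κ₁ < p ] (+ p * solutions d (c′ κ₁) u v) ≡ + p * + (p ℕ.^ d)
      by-tails (no u≢v) = trans (sum-cong-≗ {p} (λ κ₁ → solutions-≢ d (c′ κ₁) u v u≢v)) (∑-const p _)
      by-tails (yes refl) = begin
        ∑[ κ₁ < p ] (+ p * solutions d (c′ κ₁) u u)
          ≡⟨ sum-cong-≗ {p} (λ κ₁ → cong (+ p *_) (solutions-≡ d (c′ κ₁) u)) ⟩
        ∑[ κ₁ < p ] (+ p * (+ (p ℕ.^ d) * δ (c′ κ₁)))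
          ≡⟨ *-distribˡ-sum {p} (+ p) (λ κ₁ → + (p ℕ.^ d) * δ (c′ κ₁)) ⟨
        + p * ∑[ κ₁ < p ] (+ (p ℕ.^ d) * δ (c′ κ₁))
          ≡⟨ cong (+ p *_) (*-distribˡ-sum {p} (+ (p ℕ.^ d)) (δ ∘ c′)) ⟨
        + p * (+ (p ℕ.^ d) * ∑[ κ₁ < p ] δ (c′ κ₁))
          ≡⟨ cong (λ x → + p * (+ (p ℕ.^ d) * x)) one-root ⟩
        + p * (+ (p ℕ.^ d) * 1ℤ)
          ≡⟨ cong (+ p *_) (*-identityʳ _) ⟩
        + p * + (p ℕ.^ d) ∎
        where
        factor : ∀ c x a b k → c ℕ.+ x ℕ.* a ℕ.+ x ℕ.* b ℕ.* k ≡ c ℕ.+ x ℕ.* (a ℕ.+ b ℕ.* k)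
        factor = ℕSolver.solve-∀
        one-root : ∑[ κ₁ < p ] δ (c′ κ₁) ≡ 1ℤ
        one-root = trans (sum-cong-≗ {p} (λ κ₁ → cong δ (factor c (toℕ κ₁) (toℕ a) (toℕ b) k)))
                         (∑-δ-linear p-prime (≢⇒difference≢0 (λ a≡b → a∷u≢b∷v (cong (_∷ u) a≡b))) c)

    solutions-formula : ∀ d (u v : Vertex k d) →
                        + p * solutions d 0 u v ≡ + (p ℕ.^ d) + 𝟙 (u ≟ᵥ v) * + (k ℕ.* p ℕ.^ d)
    solutions-formula d u v with u ≟ᵥ v
    ... | no u≢v    = trans (solutions-≢ d 0 u v u≢v) (sym (+-identityʳ (+ (p ℕ.^ d))))
    ... | yes refl  = begin
      + p * solutions d 0 u u
        ≡⟨ cong (+ p *_) (trans (solutions-≡ d 0 u) (*-identityʳ (+ (p ℕ.^ d)))) ⟩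
      + p * + (p ℕ.^ d)
        ≡⟨ pos-* p (p ℕ.^ d) ⟨
      + (p ℕ.^ d ℕ.+ k ℕ.* p ℕ.^ d)
        ≡⟨ pos-+ (p ℕ.^ d) (k ℕ.* p ℕ.^ d) ⟩
      + (p ℕ.^ d) + + (k ℕ.* p ℕ.^ d)
        ≡⟨ cong (_+_ (+ (p ℕ.^ d))) (*-identityˡ (+ (k ℕ.* p ℕ.^ d))) ⟨
      + (p ℕ.^ d) + 1ℤ * + (k ℕ.* p ℕ.^ d) ∎
      where open ≡-Reasoning

    ∑-solutions : ∀ d (h : Vertex k d → ℤ) (u : Vertex k d → Vertex k d) v → ∑ᵥ d h ≡ 0ℤ →
                  + p * ∑ᵥ d (λ z → h z * solutions d 0 (u z) v) ≡
                  + (k ℕ.* p ℕ.^ d) * ∑ᵥ d (λ z → 𝟙 (u z ≟ᵥ v) * h z)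
    ∑-solutions d h u v ∑h≡0 = begin
      + p * ∑ᵥ d (λ z → h z * solutions d 0 (u z) v)
        ≡⟨ ∑ᵥ-*ˡ d (+ p) (λ z → h z * solutions d 0 (u z) v) ⟨
      ∑ᵥ d (λ z → + p * (h z * solutions d 0 (u z) v))
        ≡⟨ ∑ᵥ-cong d (λ z → trans (swap (+ p) (h z) _) (cong (h z *_) (solutions-formula d (u z) v))) ⟩
      ∑ᵥ d (λ z → h z * (P + 𝟙 (u z ≟ᵥ v) * Q))
        ≡⟨ ∑ᵥ-cong d (λ z → distribute (h z) P (𝟙 (u z ≟ᵥ v)) Q) ⟩
      ∑ᵥ d (λ z → P * h z + Q * (𝟙 (u z ≟ᵥ v) * h z))
        ≡⟨ ∑ᵥ-+ d (λ z → P * h z) (λ z → Q * (𝟙 (u z ≟ᵥ v) * h z)) ⟩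
      ∑ᵥ d (λ z → P * h z) + ∑ᵥ d (λ z → Q * (𝟙 (u z ≟ᵥ v) * h z))
        ≡⟨ cong₂ _+_ (trans (∑ᵥ-*ˡ d P h) (trans (cong (P *_) ∑h≡0) (*-zeroʳ P))) (∑ᵥ-*ˡ d Q _) ⟩
      0ℤ + Q * ∑ᵥ d (λ z → 𝟙 (u z ≟ᵥ v) * h z)
        ≡⟨ +-identityˡ _ ⟩
      Q * ∑ᵥ d (λ z → 𝟙 (u z ≟ᵥ v) * h z)
        ∎
      where
      open ≡-Reasoning
      P = + (p ℕ.^ d)
      Q = + (k ℕ.* p ℕ.^ d)
      swap : ∀ a b c → a * (b * c) ≡ b * (a * c)
      swap = solve-∀
      distribute : ∀ h a l q → h * (a + l * q) ≡ a * h + q * (l * h)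
      distribute = solve-∀

module Projection (k d : ℕ) (g : Vertex k d → ℤ) (Ng≡0 : ∀ z → Lattice.nbhdSum k g z ≡ 0ℤ) where

  open import Data.Integer using (_+_; _*_; -_; _-_)
  open Sums
  open Periodic k
  open Residues k
  open Lattice k

  -- B κ t is the sum of g over the hyperplane κ·z ≡ −t.
  B : Vertex k d → ℕ → ℤ
  B κ t = ∑ᵥ d (λ z → g z * δ (dot κ z ℕ.+ t))

  periodic-B : ∀ κ → Periodic (B κ)
  periodic-B κ t = ∑ᵥ-cong d λ z →
    cong (g z *_) (δ-cong (≡ₚ-trans (≡⇒≡ₚ (sym (ℕ.+-assoc (dot κ z) t p))) (+p≡ₚ (dot κ z ℕ.+ t))))

  B-translate : ∀ κ j {σ τ : Fin p → Fin p} {c} → (∀ a → σ (τ a) ≡ a) → (∀ a → toℕ (τ a) ≡ₚ toℕ a ℕ.+ c) →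
                ∀ t → ∑ᵥ d (λ z → g (updateAt z j σ) * δ (dot κ z ℕ.+ t)) ≡ B κ (t ℕ.+ toℕ (lookup κ j) ℕ.* c)
  B-translate κ j {σ} {τ} {c} σ∘τ≡id τ≡ t = begin
    ∑ᵥ d (λ z → g (updateAt z j σ) * δ (dot κ z ℕ.+ t))
      ≡⟨ ∑ᵥ-translate d j τ c τ≡ (λ z → g (updateAt z j σ) * δ (dot κ z ℕ.+ t)) ⟨
    ∑ᵥ d (λ z → g (updateAt (updateAt z j τ) j σ) * δ (dot κ (updateAt z j τ) ℕ.+ t))
      ≡⟨ ∑ᵥ-cong d (λ z → cong₂ _*_ (cong g (undo z)) (δ-cong (shift z))) ⟩
    B κ (t ℕ.+ toℕ (lookup κ j) ℕ.* c) ∎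
    where
    open ≡-Reasoning
    undo : ∀ z → updateAt (updateAt z j τ) j σ ≡ z
    undo z = trans (Vec.updateAt-updateAt-local j z (σ∘τ≡id (lookup z j))) (Vec.updateAt-id j z)
    regroup : ∀ a b t → a ℕ.+ b ℕ.+ t ≡ a ℕ.+ (t ℕ.+ b)
    regroup = ℕSolver.solve-∀
    shift : ∀ z → dot κ (updateAt z j τ) ℕ.+ t ≡ₚ dot κ z ℕ.+ (t ℕ.+ toℕ (lookup κ j) ℕ.* c)
    shift z = ≡ₚ-trans (+-congₚ (dot-updateAt κ z j τ≡) (≡ₚ-refl {t})) (≡⇒≡ₚ (regroup (dot κ z) _ t))

  -- nbhdSum g ≡ 0, projected: moving z by ±eⱼ moves κ·z by ±κⱼ.
  B-equation : ∀ κ t →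
               B κ t + ∑[ j < d ] (B κ (t ℕ.+ toℕ (lookup κ j) ℕ.* k) + B κ (t ℕ.+ toℕ (lookup κ j))) ≡ 0ℤ
  B-equation κ t = begin
    B κ t + ∑[ j < d ] (B κ (t ℕ.+ c j ℕ.* k) + B κ (t ℕ.+ c j))
      ≡⟨ cong (_+_ (B κ t)) (sum-cong-≗ {d} λ j → cong₂ _+_ (B-translate κ j sucMod∘predMod predMod≡ₚ t)
                                                         (trans (B-translate κ j predMod∘sucMod sucMod≡ₚ t)
                                                                (cong (B κ) (cong (t ℕ.+_) (ℕ.*-identityʳ (c j)))))) ⟨
    B κ t + ∑[ j < d ] (∑ᵥ d (λ z → g⁺ j z * Δ z) + ∑ᵥ d (λ z → g⁻ j z * Δ z))
      ≡⟨ cong (_+_ (B κ t)) (sum-cong-≗ {d} λ j → ∑ᵥ-+ d (λ z → g⁺ j z * Δ z) (λ z → g⁻ j z * Δ z)) ⟨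
    B κ t + ∑[ j < d ] ∑ᵥ d (λ z → g⁺ j z * Δ z + g⁻ j z * Δ z)
      ≡⟨ cong (_+_ (B κ t)) (∑ᵥ-comm-∑ d (λ z j → g⁺ j z * Δ z + g⁻ j z * Δ z)) ⟨
    B κ t + ∑ᵥ d (λ z → ∑[ j < d ] (g⁺ j z * Δ z + g⁻ j z * Δ z))
      ≡⟨ ∑ᵥ-+ d (λ z → g z * Δ z) _ ⟨
    ∑ᵥ d (λ z → g z * Δ z + ∑[ j < d ] (g⁺ j z * Δ z + g⁻ j z * Δ z))
      ≡⟨ ∑ᵥ-cong d (λ z → factor-Δ z) ⟩
    ∑ᵥ d (λ z → nbhdSum g z * Δ z)
      ≡⟨ ∑ᵥ-zero d (λ z → trans (cong (_* Δ z) (Ng≡0 z)) (*-zeroˡ (Δ z))) ⟩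
    0ℤ ∎
    where
    open ≡-Reasoning
    c : Fin d → ℕ
    c j = toℕ (lookup κ j)
    Δ : Vertex k d → ℤ
    Δ z = δ (dot κ z ℕ.+ t)
    g⁺ g⁻ : Fin d → Vertex k d → ℤ
    g⁺ j z = g (updateAt z j sucMod)
    g⁻ j z = g (updateAt z j predMod)
    factor-Δ : ∀ z → g z * Δ z + ∑[ j < d ] (g⁺ j z * Δ z + g⁻ j z * Δ z) ≡ nbhdSum g z * Δ z
    factor-Δ z = begin
      g z * Δ z + ∑[ j < d ] (g⁺ j z * Δ z + g⁻ j z * Δ z)
        ≡⟨ cong (_+_ (g z * Δ z)) (sum-cong-≗ {d} (λ j → *-distribʳ-+ (Δ z) (g⁺ j z) (g⁻ j z))) ⟨
      g z * Δ z + ∑[ j < d ] ((g⁺ j z + g⁻ j z) * Δ z)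
        ≡⟨ cong (_+_ (g z * Δ z)) (*-distribʳ-sum {d} (Δ z) (λ j → g⁺ j z + g⁻ j z)) ⟨
      g z * Δ z + ∑[ j < d ] (g⁺ j z + g⁻ j z) * Δ z
        ≡⟨ *-distribʳ-+ (Δ z) (g z) _ ⟨
      nbhdSum g z * Δ z ∎

  B⋆ν : ∀ κ t → (B κ ⋆ ν κ) t ≡
                B κ t + ∑[ j < d ] (B κ (t ℕ.+ toℕ (lookup κ j) ℕ.* k) + B κ (t ℕ.+ toℕ (lookup κ j)))
  B⋆ν κ t = begin
    total (λ s → ν κ s * h s)
      ≡⟨ total-cong expand ⟩
    total (λ s → δ s * h s + ∑[ j < d ] (b j s + b′ j s))
      ≡⟨ total-+ (λ s → δ s * h s) (λ s → ∑[ j < d ] (b j s + b′ j s)) ⟩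
    total (λ s → δ s * h s) + total (λ s → ∑[ j < d ] (b j s + b′ j s))
      ≡⟨ cong (_+_ (total (λ s → δ s * h s))) (∑-comm {p} {d} (λ s j → b j (toℕ s) + b′ j (toℕ s))) ⟩
    total (λ s → δ s * h s) + ∑[ j < d ] total (λ s → b j s + b′ j s)
      ≡⟨ cong₂ _+_ (total-δ* h) (sum-cong-≗ {d} λ j → trans (total-+ (b j) (b′ j))
           (cong₂ _+_ (total-δ-shift* h-per (c j)) (total-δ-shift* h-per (c j ℕ.* k)))) ⟩
    h 0 + ∑[ j < d ] (h (c j ℕ.* k) + h (c j ℕ.* k ℕ.* k))
      ≡⟨ cong₂ _+_ (cong (B κ) (ℕ.+-identityʳ t)) (sum-cong-≗ {d} λ j → cong (_+_ (h (c j ℕ.* k)))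
           (periodic-resp-% (periodic-B κ) (%≡% (+-congₚ (≡ₚ-refl {t}) (k*k≡ₚ1 (c j)))))) ⟩
    B κ t + ∑[ j < d ] (B κ (t ℕ.+ c j ℕ.* k) + B κ (t ℕ.+ c j))
      ∎
    where
    open ≡-Reasoning
    c : Fin d → ℕ
    c j = toℕ (lookup κ j)
    h : ℕ → ℤ
    h s = B κ (t ℕ.+ s)
    h-per : Periodic h
    h-per u = trans (cong (B κ) (sym (ℕ.+-assoc t u p))) (periodic-B κ (t ℕ.+ u))
    b b′ : Fin d → ℕ → ℤ
    b  j s = δ (s ℕ.+ c j) * h s
    b′ j s = δ (s ℕ.+ c j ℕ.* k) * h s
    expand : ∀ s → ν κ s * h s ≡ δ s * h s + ∑[ j < d ] (b j s + b′ j s)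
    expand s = begin
      (δ s + ∑[ j < d ] (δ (s ℕ.+ c j) + δ (s ℕ.+ c j ℕ.* k))) * h s
        ≡⟨ *-distribʳ-+ (h s) (δ s) _ ⟩
      δ s * h s + ∑[ j < d ] (δ (s ℕ.+ c j) + δ (s ℕ.+ c j ℕ.* k)) * h s
        ≡⟨ cong (_+_ (δ s * h s)) (*-distribʳ-sum {d} (h s) (λ j → δ (s ℕ.+ c j) + δ (s ℕ.+ c j ℕ.* k))) ⟩
      δ s * h s + ∑[ j < d ] ((δ (s ℕ.+ c j) + δ (s ℕ.+ c j ℕ.* k)) * h s)
        ≡⟨ cong (_+_ (δ s * h s)) (sum-cong-≗ {d} (λ j → *-distribʳ-+ (h s) (δ (s ℕ.+ c j)) (δ (s ℕ.+ c j ℕ.* k)))) ⟩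
      δ s * h s + ∑[ j < d ] (b j s + b′ j s)
        ∎

  B⋆ν-constant : ∀ κ → Constant (B κ ⋆ ν κ)
  B⋆ν-constant κ t = trans (trans (B⋆ν κ t) (B-equation κ t)) (sym (trans (B⋆ν κ 0) (B-equation κ 0)))

  total-B : ∀ κ → total (B κ) ≡ ∑ᵥ d g
  total-B κ = begin
    total (λ t → ∑ᵥ d (λ z → g z * δ (dot κ z ℕ.+ t)))
      ≡⟨ ∑ᵥ-comm-∑ d {p} (λ z t → g z * δ (dot κ z ℕ.+ toℕ t)) ⟨
    ∑ᵥ d (λ z → total (λ t → g z * δ (dot κ z ℕ.+ t)))
      ≡⟨ ∑ᵥ-cong d (λ z → trans (total-*ˡ (g z) (λ t → δ (dot κ z ℕ.+ t))) (cong (g z *_) (total-δ-at z))) ⟩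
    ∑ᵥ d (λ z → g z * 1ℤ)
      ≡⟨ ∑ᵥ-cong d (λ z → *-identityʳ (g z)) ⟩
    ∑ᵥ d g ∎
    where
    open ≡-Reasoning
    total-δ-at : ∀ z → total (λ t → δ (dot κ z ℕ.+ t)) ≡ 1ℤ
    total-δ-at z = trans (total-cong (λ t → cong δ (ℕ.+-comm (dot κ z) t))) (total-δ-shift (dot κ z))

  ∑-B-zeroAt : ∀ i x → ∑ᵥ d (λ κ → B (zeroAt i κ) (dot (zeroAt i κ) x ℕ.* k)) ≡
                       ∑ᵥ d (λ z → g z * solutions d 0 (zeroAt i z) (zeroAt i x))
  ∑-B-zeroAt i x = begin
    ∑ᵥ d (λ κ → ∑ᵥ d (λ z → g z * δ (dot (zeroAt i κ) z ℕ.+ dot (zeroAt i κ) x ℕ.* k)))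
      ≡⟨ ∑ᵥ-cong d (λ κ → ∑ᵥ-cong d (λ z → cong (λ y → g z * δ y)
           (cong₂ (λ a b → a ℕ.+ b ℕ.* k) (dot-zeroAt κ z i) (dot-zeroAt κ x i)))) ⟩
    ∑ᵥ d (λ κ → ∑ᵥ d (λ z → g z * δ (dot κ (zeroAt i z) ℕ.+ dot κ v ℕ.* k)))
      ≡⟨ ∑ᵥ-comm d d (λ κ z → g z * δ (dot κ (zeroAt i z) ℕ.+ dot κ v ℕ.* k)) ⟩
    ∑ᵥ d (λ z → ∑ᵥ d (λ κ → g z * δ (dot κ (zeroAt i z) ℕ.+ dot κ v ℕ.* k)))
      ≡⟨ ∑ᵥ-cong d (λ z → ∑ᵥ-*ˡ d (g z) (λ κ → δ (dot κ (zeroAt i z) ℕ.+ dot κ v ℕ.* k))) ⟩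
    ∑ᵥ d (λ z → g z * solutions d 0 (zeroAt i z) v)
      ∎
    where
    open ≡-Reasoning
    v = zeroAt i x

open Sums

module PerfectCode (n : ℕ) (n≥1 : n ≥ 1) (p-prime : Prime (suc (2 ℕ.* n)))
                   (S : Vertex (2 ℕ.* n) n → Set) (S-perfect : PerfectDominating S) where

  open import Data.Integer using (_+_; _*_; -_; _-_)

  k : ℕ
  k = 2 ℕ.* n

  open Periodic k
  open Residues k
  open Lattice k
  open Rigidity n

  2≤k : 2 ℕ.≤ k
  2≤k = ℕ.*-monoʳ-≤ 2 n≥1

  dominator : Vertex k n → Vertex k n
  dominator v = proj₁ (S-perfect v)

  dominator-∈S : ∀ v → S (dominator v)
  dominator-∈S v = proj₁ (proj₁ (proj₂ (S-perfect v)))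

  dominator-dominates : ∀ v → Dominates (dominator v) v
  dominator-dominates v = proj₂ (proj₁ (proj₂ (S-perfect v)))

  dominator-unique : ∀ {s v} → S s → Dominates s v → s ≡ dominator v
  dominator-unique {s} {v} s∈S s-dom = proj₂ (proj₂ (S-perfect v)) s (s∈S , s-dom)

  -- S need not be decidable, but u ∈ S iff u is its own dominator.
  χ : Vertex k n → ℤ
  χ u = 𝟙 (dominator u ≟ᵥ u)

  χ≡1⇒∈S : ∀ {u} → χ u ≡ 1ℤ → S u
  χ≡1⇒∈S {u} χu≡1 = subst S (𝟙≡1⇒ (dominator u ≟ᵥ u) χu≡1) (dominator-∈S u)

  ∈S⇒χ≡1 : ∀ {u} → S u → χ u ≡ 1ℤ
  ∈S⇒χ≡1 {u} u∈S = 𝟙-yes (dominator u ≟ᵥ u) (sym (dominator-unique u∈S (inj₁ refl)))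

  χ≡𝟙[≡dominator] : ∀ {u v} → Dominates u v → χ u ≡ 𝟙 (u ≟ᵥ dominator v)
  χ≡𝟙[≡dominator] {u} {v} u-dom with dominator u ≟ᵥ u
  ... | yes u∈S = sym (𝟙-yes (u ≟ᵥ dominator v) (dominator-unique (subst S u∈S (dominator-∈S u)) u-dom))
  ... | no  u∉S = sym (𝟙-no (u ≟ᵥ dominator v) λ u≡dv →
                    u∉S (sym (dominator-unique (subst S (sym u≡dv) (dominator-∈S v)) (inj₁ refl))))

  nbhdSum-χ : ∀ v → nbhdSum χ v ≡ 1ℤ
  nbhdSum-χ v = trans
    (cong₂ _+_ (χ≡𝟙[≡dominator] (inj₁ refl)) (sum-cong-≗ {n} λ j →
       cong₂ _+_ (χ≡𝟙[≡dominator] (sucMod-dominates v j)) (χ≡𝟙[≡dominator] (predMod-dominates v j))))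
    (nbhdSum-𝟙 2≤k v (dominates⇒InNbhd (dominator-dominates v)))

  g : Vertex k n → ℤ
  g u = + p * χ u - 1ℤ

  -- Every closed neighbourhood has 2n + 1 = p vertices, exactly one of them in S.
  Ng≡0 : ∀ v → nbhdSum g v ≡ 0ℤ
  Ng≡0 v = begin
    nbhdSum g v                       ≡⟨ nbhdSum-affine (+ p) (- 1ℤ) χ v ⟩
    + p * nbhdSum χ v + + p * - 1ℤ    ≡⟨ cong (λ x → + p * x + + p * - 1ℤ) (nbhdSum-χ v) ⟩
    + p * 1ℤ + + p * - 1ℤ             ≡⟨ *-distribˡ-+ (+ p) 1ℤ (- 1ℤ) ⟨
    + p * 0ℤ                          ≡⟨ *-zeroʳ (+ p) ⟩
    0ℤ                                ∎
    where open ≡-Reasoning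

  open Projection k n g Ng≡0

  *p≡0⇒≡0 : ∀ {x} → + p * x ≡ 0ℤ → x ≡ 0ℤ
  *p≡0⇒≡0 {x} px≡0 = *-cancelˡ-≡ (+ p) x 0ℤ (trans px≡0 (sym (*-zeroʳ (+ p))))

  ∑g≡0 : ∑ᵥ n g ≡ 0ℤ
  ∑g≡0 = *p≡0⇒≡0 (trans (sym (∑ᵥ-nbhdSum n g)) (∑ᵥ-zero n Ng≡0))

  module _ (i : Fin n) where

    -- ν κ has total weight p but weight at least 3 at 0.
    total-ν≢ : ∀ {κ} → lookup κ i ≡ Fin.zero → total (ν κ) ≢ + p * ν κ 0
    total-ν≢ {κ} κᵢ≡0 total≡ = 3≰1 (subst (+ 3 ≤_) ν[0]≡1 (3≤ν[0] {κ = κ} i κᵢ≡0))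
      where
      3≰1 : ¬ (+ 3 ≤ 1ℤ)
      3≰1 (+≤+ (ℕ.s≤s ()))
      ν[0]≡1 : ν κ 0 ≡ 1ℤ
      ν[0]≡1 = *-cancelˡ-≡ (+ p) (ν κ 0) 1ℤ (trans (sym total≡) (trans (total-ν κ) (sym (*-identityʳ (+ p)))))

    B≡0 : ∀ {κ} → lookup κ i ≡ Fin.zero → ∀ t → B κ t ≡ 0ℤ
    B≡0 {κ} κᵢ≡0 t = trans (B-constant t) (*p≡0⇒≡0 (begin
      + p * B κ 0     ≡⟨ total-constant B-constant ⟨
      total (B κ)     ≡⟨ total-B κ ⟩
      ∑ᵥ n g          ≡⟨ ∑g≡0 ⟩
      0ℤ              ∎))
      where
      open ≡-Reasoning
      B-constant : Constant (B κ)
      B-constant =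
        ⋆-constant⇒constant p-prime (periodic-B κ) (periodic-ν κ) (B⋆ν-constant κ) (total-ν≢ {κ} κᵢ≡0)

    module _ (x : Vertex k n) where

      line : Fin p → Vertex k n
      line t = updateAt x i (λ _ → t)

      ∑-line-g≡0 : ∑[ t < p ] g (line t) ≡ 0ℤ
      ∑-line-g≡0 = begin
        ∑[ t < p ] g (line t)  ≡⟨ ∑ᵥ-line n i x g ⟨
        L                      ≡⟨ *-cancelˡ-≡ Q L 0ℤ {{Q≢0}} (trans QL≡0 (sym (*-zeroʳ Q))) ⟩
        0ℤ                     ∎
        where
        open ≡-Reasoning
        Q = + (k ℕ.* p ℕ.^ n)
        Q≢0 : ℤ.NonZero Q
        Q≢0 = ℕ.m*n≢0 k (p ℕ.^ n) {{ℕ.>-nonZero (ℕ.<-trans ℕ.z<s 2≤k)}} {{ℕ.m^n≢0 p n}}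
        L = ∑ᵥ n (λ z → 𝟙 (zeroAt i z ≟ᵥ zeroAt i x) * g z)
        QL≡0 : Q * L ≡ 0ℤ
        QL≡0 = begin
          Q * L
            ≡⟨ ∑-solutions p-prime n g (zeroAt i) (zeroAt i x) ∑g≡0 ⟨
          + p * ∑ᵥ n (λ z → g z * solutions n 0 (zeroAt i z) (zeroAt i x))
            ≡⟨ cong (+ p *_) (∑-B-zeroAt i x) ⟨
          + p * ∑ᵥ n (λ κ → B (zeroAt i κ) (dot (zeroAt i κ) x ℕ.* k))
            ≡⟨ cong (+ p *_) (∑ᵥ-zero n vanish) ⟩
          + p * 0ℤ
            ≡⟨ *-zeroʳ (+ p) ⟩
          0ℤ ∎
          where
          vanish : ∀ κ → B (zeroAt i κ) (dot (zeroAt i κ) x ℕ.* k) ≡ 0ℤ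
          vanish κ = B≡0 {zeroAt i κ} (Vec.lookup∘updateAt i κ) (dot (zeroAt i κ) x ℕ.* k)

      ∑-line-χ≡1 : ∑[ t < p ] χ (line t) ≡ 1ℤ
      ∑-line-χ≡1 = i-j≡0⇒i≡j _ 1ℤ (*p≡0⇒≡0 (begin
        + p * (X - 1ℤ)
          ≡⟨ factor (+ p) X ⟩
        + p * X - + p * 1ℤ
          ≡⟨ cong₂ _-_ (sym (*-distribˡ-sum {p} (+ p) (χ ∘ line))) (∑-const p 1ℤ) ⟨
        ∑[ t < p ] (+ p * χ (line t)) - ∑[ t < p ] 1ℤ
          ≡⟨ ∑-distrib-- {p} (λ t → + p * χ (line t)) (λ _ → 1ℤ) ⟨
        ∑[ t < p ] g (line t)
          ≡⟨ ∑-line-g≡0 ⟩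
        0ℤ ∎))
        where
        open ≡-Reasoning
        X = ∑[ t < p ] χ (line t)
        factor : ∀ a x → a * (x - 1ℤ) ≡ a * x - a * 1ℤ
        factor = solve-∀

      exactly-one : ExactlyOne (λ y → S y × (∀ j → j ≢ i → lookup y j ≡ lookup x j))
      exactly-one = from-line
        (∑-bits≡1⇒exactlyOne {p} {χ ∘ line} (λ t → 𝟙-bit (dominator (line t) ≟ᵥ line t)) ∑-line-χ≡1)
        where
        on-line : ∀ y → (∀ j → j ≢ i → lookup y j ≡ lookup x j) → y ≡ line (lookup y i)
        on-line y y≗x = ≡updateAt {σ = λ _ → lookup y i} i refl y≗x
        from-line : ExactlyOne (λ t → χ (line t) ≡ 1ℤ) →
                    ExactlyOne (λ y → S y × (∀ j → j ≢ i → lookup y j ≡ lookup x j))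
        from-line (t₀ , χ≡1 , unique) =
          line t₀ , (χ≡1⇒∈S χ≡1 , λ j j≢i → Vec.lookup∘updateAt′ j i j≢i x) , λ y (y∈S , y≗x) →
            trans (on-line y y≗x)
                  (cong line (unique (lookup y i) (subst (λ w → χ w ≡ 1ℤ) (on-line y y≗x) (∈S⇒χ≡1 y∈S))))

open import Data.Nat using (_+_; _*_)

theorem1 : (n : ℕ) → n ≥ 1 → Prime (2 * n + 1) →
    (S : Vertex (2 * n) n → Set) → PerfectDominating S →
    (x : Vertex (2 * n) n) (i : Fin n) →
    ExactlyOne (λ y → S y × (∀ j → j ≢ i → lookup y j ≡ lookup x j))
theorem1 n n≥1 p-prime S S-perfect x i =
  PerfectCode.exactly-one n n≥1 (subst Prime (ℕ.+-comm (2 * n) 1) p-prime) S S-perfect i x
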